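{- Let $A\geq a\geq 1$ and $r\geq 2$ be integers, and let $O\widetilde{mes}_{r,A,a}$ be the set of overpartitions $\pi$ such that all parts of $\pi$ of size $\equiv a\pmod A$ and less than $\widetilde{mes}_{r,A,a}(\pi)$ are overlined. Then \[ \sum_{\pi \in O\widetilde{mes}_{r,A,a}}z^{\widetilde{mes}_{r,A,a}(\pi)}q^{|\pi|} =\frac{(-q;q)_{\infty }}{(q;q)_{\infty}}\sum_{k=0}^{\infty }z^{kA+a}\bigg[q^{A\binom{k}{2}+ka}\frac{(q^{a};q^{A})_{k}}{(-q^{a};q^{A})_{k+1 }}-q^{A\binom{k}{2}+ka+(r-1)(kA+a)}\frac{(q^{a};q^{A})_{k}}{(-q^{a};q^{A})_{k+1}}\bigg]. \]
   Context: An overpartition is a partition (finite non-increasing sequence of positive integers) in which the first occurrence of each part value may be overlined; $|\pi|$ is the sum of parts. A part is of size $t$ if it equals $t$ or $\overline{t}$. $(a;q)_\infty=\prod_{i\geq0}(1-aq^i)$, $(a;q)_n=(a;q)_\infty/(aq^n;q)_\infty$; $|q|<1$, $z$ a formal variable. For $r\geq2$, $\widetilde{mes}_{r,A,a}(\pi)$ is the smallest positive integer $m\equiv a\pmod A$ such that $\pi$ has no overlined part $\overline{m}$ and $\pi$ has fewer than $r-1$ non-overlined parts equal to $m$. -}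

module Defs where

open import Data.Nat as ℕ using (ℕ; zero; suc; _≤_; _<_; NonZero; _%_; _≡ᵇ_; _<ᵇ_)
open import Data.Nat.Combinatorics using (_C_)
open import Data.Integer as ℤ using (ℤ)
open import Data.Bool using (Bool; true; false; _∧_; _∨_; not; if_then_else_)
open import Data.List using (List; []; _∷_; length; map; zipWith; upTo; foldr)
open import Data.List.Relation.Unary.All using (All)
open import Data.List.Relation.Unary.Linked using (Linked)
open import Data.Product using (Σ; _×_; _,_; proj₁)
open import Data.Sum using (_⊎_)
open import Relation.Binary.PropositionalEquality using (_≡_)

sumℕ : List ℕ → ℕ
sumℕ = foldr ℕ._+_ 0

sumℤ : List ℤ → ℤ
sumℤ = foldr ℤ._+_ ℤ.0ℤ

-- A part is a pair (t , o): its size t and whether it is overlined (o = true).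
Part : Set
Part = ℕ × Bool

-- Consecutive parts p ∷ p′ ∷ … (listed in non-increasing order): the next part
-- is either strictly smaller, or of the same size and non-overlined (so only
-- the first occurrence of a size may be overlined).  This gives a unique
-- canonical list for each overpartition.
_Follows_ : Part → Part → Set
(t , o) Follows (s , o′) = s < t ⊎ (s ≡ t × o′ ≡ false)

record Overpartition : Set where
  constructor mkOP
  field
    parts    : List Part
    positive : All (λ p → 1 ≤ proj₁ p) parts
    ordered  : Linked _Follows_ parts
open Overpartition public

weight : Overpartition → ℕ
weight π = sumℕ (map proj₁ (parts π))

hasOverlined : ℕ → Overpartition → Bool
hasOverlined m π = foldr (λ p acc → ((proj₁ p ≡ᵇ m) ∧ Data.Product.proj₂ p) ∨ acc) false (parts π)
  where import Data.Product

nonOverCount : ℕ → Overpartition → ℕ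
nonOverCount m π =
  foldr (λ p acc → if (proj₁ p ≡ᵇ m) ∧ not (Data.Product.proj₂ p) then suc acc else acc) 0 (parts π)
  where import Data.Product

mesCandidate : (r A a : ℕ) .{{_ : NonZero A}} → Overpartition → ℕ → Bool
mesCandidate r A a π m =
  (0 <ᵇ m) ∧ ((m % A) ≡ᵇ (a % A)) ∧ not (hasOverlined m π)
    ∧ (nonOverCount m π <ᵇ (r ℕ.∸ 1))

searchFrom : (ℕ → Bool) → (fuel start : ℕ) → ℕ
searchFrom P zero    start = start
searchFrom P (suc f) start = if P start then start else searchFrom P f (suc start)

-- mes~_{r,A,a}(π): the smallest positive integer m ≡ a (mod A) such that π has
-- no overlined part m and fewer than r-1 non-overlined parts equal to m.
-- (Searching m = 1, 2, … ; the fuel a + A·(1 + #parts) suffices since among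
-- a, a+A, …, a + A·#parts at least one size does not occur in π.)
mes : (r A a : ℕ) .{{_ : NonZero A}} → Overpartition → ℕ
mes r A a π = searchFrom (mesCandidate r A a π) (a ℕ.+ A ℕ.* suc (length (parts π))) 1

inOMes : (r A a : ℕ) .{{_ : NonZero A}} → Overpartition → Bool
inOMes r A a π =
  foldr (λ p acc → (not (((proj₁ p % A) ≡ᵇ (a % A)) ∧ (proj₁ p <ᵇ mes r A a π)) ∨ Data.Product.proj₂ p) ∧ acc)
        true (parts π)
  where import Data.Product

-- Overpartitions π ∈ O mes~_{r,A,a} with mes~(π) = m and |π| = n
-- (the objects counted by the coefficient of z^m q^n on the left-hand side).
OMesSet : (r A a : ℕ) .{{_ : NonZero A}} → (m n : ℕ) → Set
OMesSet r A a m n =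
  Σ Overpartition λ π → (inOMes r A a π ≡ true) × (mes r A a π ≡ m) × (weight π ≡ n)

PS : Set
PS = ℕ → ℤ

_⊕_ : PS → PS → PS
(f ⊕ g) n = f n ℤ.+ g n

_⊖_ : PS → PS → PS
(f ⊖ g) n = f n ℤ.- g n

_⊗_ : PS → PS → PS
(f ⊗ g) n = sumℤ (map (λ i → f i ℤ.* g (n ℕ.∸ i)) (upTo (suc n)))

infixl 6 _⊕_ _⊖_
infixl 7 _⊗_

mono : ℤ → ℕ → PS
mono c e n = if e ≡ᵇ n then c else ℤ.0ℤ

one : PS
one = mono ℤ.1ℤ 0

prodF : (ℕ → PS) → ℕ → PS
prodF f zero    = one
prodF f (suc k) = prodF f k ⊗ f k

-- (c q^s ; q^d)_k = ∏_{i<k} (1 - c q^{s + d i})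
poch : ℤ → (s d k : ℕ) → PS
poch c s d k = prodF (λ i → one ⊖ mono c (s ℕ.+ d ℕ.* i)) k

-- (c q^s ; q^d)_∞ for s ≥ 1, d ≥ 1: the factors with index i ≥ n are ≡ 1 mod q^{n+1},
-- so the n-th coefficient equals that of the finite product with n+1 factors.
pochInf : ℤ → (s d : ℕ) → PS
pochInf c s d n = poch c s d (suc n) n

-- Multiplicative inverse of a power series f with constant term 1:
-- g_0 = 1, g_n = - Σ_{1≤i≤n} f_i g_{n-i}.
-- invList f n = [g_n, g_{n-1}, …, g_0]
invList : PS → ℕ → List ℤ
invList f zero    = ℤ.1ℤ ∷ []
invList f (suc n) =
  ℤ.- sumℤ (zipWith ℤ._*_ (map (λ i → f (suc i)) (upTo (suc n))) (invList f n))
    ∷ invList f n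

inv1 : PS → PS
inv1 f n with invList f n
... | x ∷ _ = x
... | []    = ℤ.0ℤ

rhsTerm : (r A a k : ℕ) → PS
rhsTerm r A a k =
  (pochInf (ℤ.- ℤ.1ℤ) 1 1 ⊗ inv1 (pochInf ℤ.1ℤ 1 1))
    ⊗ (mono ℤ.1ℤ e₁ ⊗ frac ⊖ mono ℤ.1ℤ e₂ ⊗ frac)
  where
    e₁ = A ℕ.* (k C 2) ℕ.+ k ℕ.* a
    e₂ = e₁ ℕ.+ (r ℕ.∸ 1) ℕ.* (k ℕ.* A ℕ.+ a)
    frac = poch ℤ.1ℤ a A k ⊗ inv1 (poch (ℤ.- ℤ.1ℤ) a A (suc k))

-- Coefficient of z^m q^n in Σ_{k≥0} z^{kA+a} F_k(q).  Since A ≥ 1 (and a ≥ 1),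
-- only k ≤ m can have kA + a = m.
rhsCoeff : (r A a m n : ℕ) → ℤ
rhsCoeff r A a m n =
  sumℤ
    (map (λ k → if (k ℕ.* A ℕ.+ a) ≡ᵇ m then rhsTerm r A a k n else ℤ.0ℤ) (upTo (suc m)))

module Submission where

-- Every mes~(π) is a term m = kA + a of the progression a, a + A, …, so both sides vanish for other m.
-- For m = kA + a and |π| = n, the conditions π ∈ O mes~ and mes~(π) = m are conditions on the parts of each
-- size s ≤ L = n + m separately: for s = a, a + A, …, m - A exactly one part, overlined; for s = m no
-- overlined part and fewer than r - 1 others; nothing otherwise. Splitting off the parts of the largest size
-- shows that the generating function of such overpartitions is the product of the per-size generating
-- functions. After multiplication by (q; q)_L (-q^a; q^A)_{k+1} every size contributes a simple factor, and
-- the product becomes (-q; q)_L q^(A C(k,2) + k a) (q^a; q^A)_k (1 - q^(m (r - 1))) modulo q^(n + 1). As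
-- L > n, the finite products (±q; q)_L may be replaced by (±q; q)_∞ there, which gives the coefficient of z^m
-- on the right-hand side.

open import Defs
open import Data.Nat using (ℕ; NonZero; _≤_)
open import Data.Bool using (Bool)

module PowerSeries where

  open import Data.Nat as ℕ using (ℕ; zero; suc; _≤_; _<_; z≤n; s≤s)
  import Data.Nat.Properties as ℕP
  open import Data.Integer as ℤ using (ℤ; _+_; _*_; -_; _-_; 0ℤ; 1ℤ)
  import Data.Integer.Properties as ℤP
  open import Data.Integer.Solver using (module +-*-Solver)
  open import Data.List using (List; _∷_; map; upTo; zipWith)
  import Data.List.Properties as ListP
  open import Data.Bool using (Bool; true; false; if_then_else_)
  open import Data.Product using (_,_)
  open import Data.Sum using (inj₁; inj₂)
  open import Data.Empty using (⊥-elim)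
  open import Function using (_∘_)
  open import Algebra.Bundles using (CommutativeMonoid)
  import Algebra.Solver.CommutativeMonoid as CommutativeMonoidSolver
  open import Level using (0ℓ)
  open import Relation.Binary.Bundles using (Setoid)
  open import Relation.Binary.PropositionalEquality

  open +-*-Solver using (solve; _:+_; _:*_; :-_; _:=_)

  infix 4 _≈_ _≈[_]_

  _≈_ : PS → PS → Set
  f ≈ g = ∀ n → f n ≡ g n

  _≈[_]_ : PS → ℕ → PS → Set
  f ≈[ N ] g = ∀ i → i ≤ N → f i ≡ g i

  ≈⇒≈[] : ∀ {f g} N → f ≈ g → f ≈[ N ] g
  ≈⇒≈[] N f≈g i _ = f≈g i

  ≈[]-setoid : ℕ → Setoid 0ℓ 0ℓ
  ≈[]-setoid N = record
    { Carrier = PS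
    ; _≈_ = _≈[ N ]_
    ; isEquivalence = record
      { refl = λ _ _ → refl
      ; sym = λ f≈g i i≤N → sym (f≈g i i≤N)
      ; trans = λ f≈g g≈h i i≤N → trans (f≈g i i≤N) (g≈h i i≤N)
      }
    }

  zeroPS : PS
  zeroPS _ = 0ℤ

  tail : PS → PS
  tail f i = f (suc i)

  scale : ℤ → PS → PS
  scale c f i = c * f i

  map-upTo-suc : ∀ {A : Set} (h : ℕ → A) n → map h (upTo (suc n)) ≡ h 0 ∷ map (h ∘ suc) (upTo n)
  map-upTo-suc h n = cong (h 0 ∷_) (trans (ListP.map-applyUpTo suc h n) (sym (ListP.map-upTo (h ∘ suc) n)))

  sumℤ-select-none : ∀ N {P : ℕ → Bool} (g : ℕ → ℤ) → (∀ i → P i ≡ false) →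
    sumℤ (map (λ i → if P i then g i else 0ℤ) (upTo N)) ≡ 0ℤ
  sumℤ-select-none zero g none = refl
  sumℤ-select-none (suc N) {P} g none = trans (cong sumℤ (map-upTo-suc (λ i → if P i then g i else 0ℤ) N))
    (cong₂ _+_ (cong (λ b → if b then g 0 else 0ℤ) (none 0)) (sumℤ-select-none N (g ∘ suc) (none ∘ suc)))

  sumℤ-select-one : ∀ N {P : ℕ → Bool} (g : ℕ → ℤ) {k} → k < N → P k ≡ true → (∀ i → i ≢ k → P i ≡ false) →
    sumℤ (map (λ i → if P i then g i else 0ℤ) (upTo N)) ≡ g k
  sumℤ-select-one (suc N) {P} g {zero} _ P0 others = trans (cong sumℤ (map-upTo-suc (λ i → if P i then g i else 0ℤ) N))
    (trans (cong₂ _+_ (cong (λ b → if b then g 0 else 0ℤ) P0) (sumℤ-select-none N (g ∘ suc) (λ i → others (suc i) λ ())))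
           (ℤP.+-identityʳ (g 0)))
  sumℤ-select-one (suc N) {P} g {suc k} (s≤s k<N) Pk others = trans (cong sumℤ (map-upTo-suc (λ i → if P i then g i else 0ℤ) N))
    (trans (cong₂ _+_ (cong (λ b → if b then g 0 else 0ℤ) (others 0 λ ()))
                        (sumℤ-select-one N (g ∘ suc) k<N Pk (λ i i≢k → others (suc i) (i≢k ∘ ℕP.suc-injective))))
           (ℤP.+-identityˡ (g (suc k))))

  ⊗-at-0 : ∀ f g → (f ⊗ g) 0 ≡ f 0 * g 0
  ⊗-at-0 f g = ℤP.+-identityʳ (f 0 * g 0)

  ⊗-at-suc : ∀ f g n → (f ⊗ g) (suc n) ≡ f 0 * g (suc n) + (tail f ⊗ g) n
  ⊗-at-suc f g n = cong sumℤ (map-upTo-suc (λ i → f i * g (suc n ℕ.∸ i)) (suc n))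

  ⊗-cong[] : ∀ {f f′ g g′ N} → f ≈[ N ] f′ → g ≈[ N ] g′ → f ⊗ g ≈[ N ] f′ ⊗ g′
  ⊗-cong[] {f} {f′} {g} {g′} f≈f′ g≈g′ zero _ = begin
    (f ⊗ g) 0     ≡⟨ ⊗-at-0 f g ⟩
    f 0 * g 0     ≡⟨ cong₂ _*_ (f≈f′ 0 z≤n) (g≈g′ 0 z≤n) ⟩
    f′ 0 * g′ 0   ≡⟨ ⊗-at-0 f′ g′ ⟨
    (f′ ⊗ g′) 0   ∎
    where open ≡-Reasoning
  ⊗-cong[] {f} {f′} {g} {g′} f≈f′ g≈g′ (suc i) i<N = begin
    (f ⊗ g) (suc i)                          ≡⟨ ⊗-at-suc f g i ⟩
    f 0 * g (suc i) + (tail f ⊗ g) i         ≡⟨ cong₂ _+_ (cong₂ _*_ (f≈f′ 0 z≤n) (g≈g′ (suc i) i<N))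
                                                   (⊗-cong[] (λ j j≤i → f≈f′ (suc j) (ℕP.≤-trans (s≤s j≤i) i<N))
                                                             (λ j j≤i → g≈g′ j (ℕP.≤-trans j≤i (ℕP.<⇒≤ i<N))) i ℕP.≤-refl) ⟩
    f′ 0 * g′ (suc i) + (tail f′ ⊗ g′) i     ≡⟨ ⊗-at-suc f′ g′ i ⟨
    (f′ ⊗ g′) (suc i)                        ∎
    where open ≡-Reasoning

  ⊗-cong : ∀ {f f′ g g′} → f ≈ f′ → g ≈ g′ → f ⊗ g ≈ f′ ⊗ g′
  ⊗-cong f≈f′ g≈g′ n = ⊗-cong[] (≈⇒≈[] n f≈f′) (≈⇒≈[] n g≈g′) n ℕP.≤-refl

  ⊗-zeroˡ : ∀ {f} g → f ≈ zeroPS → f ⊗ g ≈ zeroPS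
  ⊗-zeroˡ {f} g f≈0 zero = trans (⊗-at-0 f g) (cong (_* g 0) (f≈0 0))
  ⊗-zeroˡ {f} g f≈0 (suc n) = trans (⊗-at-suc f g n)
    (cong₂ _+_ (cong (_* g (suc n)) (f≈0 0)) (⊗-zeroˡ g (f≈0 ∘ suc) n))

  ⊗-identityˡ : ∀ f → one ⊗ f ≈ f
  ⊗-identityˡ f zero = trans (⊗-at-0 one f) (ℤP.*-identityˡ (f 0))
  ⊗-identityˡ f (suc n) = trans (⊗-at-suc one f n)
    (trans (cong₂ _+_ (ℤP.*-identityˡ (f (suc n))) (⊗-zeroˡ f (λ _ → refl) n)) (ℤP.+-identityʳ _))

  scale-⊗ : ∀ c f g → scale c f ⊗ g ≈ scale c (f ⊗ g)
  scale-⊗ c f g zero = trans (⊗-at-0 (scale c f) g) (trans (ℤP.*-assoc c (f 0) (g 0)) (cong (c *_) (sym (⊗-at-0 f g))))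
  scale-⊗ c f g (suc n) = trans (⊗-at-suc (scale c f) g n) (trans
    (cong₂ _+_ (ℤP.*-assoc c (f 0) (g (suc n))) (scale-⊗ c (tail f) g n))
    (trans (sym (ℤP.*-distribˡ-+ c _ _)) (cong (c *_) (sym (⊗-at-suc f g n)))))

  ⊗-distribʳ-⊕ : ∀ f g h → (f ⊕ g) ⊗ h ≈ f ⊗ h ⊕ g ⊗ h
  ⊗-distribʳ-⊕ f g h zero = trans (⊗-at-0 (f ⊕ g) h) (trans (ℤP.*-distribʳ-+ (h 0) (f 0) (g 0))
    (sym (cong₂ _+_ (⊗-at-0 f h) (⊗-at-0 g h))))
  ⊗-distribʳ-⊕ f g h (suc n) = trans (⊗-at-suc (f ⊕ g) h n) (trans
    (cong₂ _+_ (ℤP.*-distribʳ-+ (h (suc n)) (f 0) (g 0)) (⊗-distribʳ-⊕ (tail f) (tail g) h n))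
    (trans (interchange (f 0 * h (suc n)) (g 0 * h (suc n)) ((tail f ⊗ h) n) ((tail g ⊗ h) n)) (sym (cong₂ _+_ (⊗-at-suc f h n) (⊗-at-suc g h n)))))
    where
    interchange : ∀ a b c d → (a + b) + (c + d) ≡ (a + c) + (b + d)
    interchange = solve 4 (λ a b c d → (a :+ b) :+ (c :+ d) := (a :+ c) :+ (b :+ d)) refl

  ⊗-distribʳ-⊖ : ∀ f g h → (f ⊖ g) ⊗ h ≈ f ⊗ h ⊖ g ⊗ h
  ⊗-distribʳ-⊖ f g h zero = trans (⊗-at-0 (f ⊖ g) h) (trans (lemma (f 0) (g 0) (h 0))
    (sym (cong₂ _-_ (⊗-at-0 f h) (⊗-at-0 g h))))
    where
    lemma : ∀ a b c → (a + - b) * c ≡ a * c + - (b * c)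
    lemma = solve 3 (λ a b c → (a :+ (:- b)) :* c := a :* c :+ (:- (b :* c))) refl
  ⊗-distribʳ-⊖ f g h (suc n) = trans (⊗-at-suc (f ⊖ g) h n) (trans
    (cong ((f 0 - g 0) * h (suc n) +_) (⊗-distribʳ-⊖ (tail f) (tail g) h n))
    (trans (lemma (f 0) (g 0) (h (suc n)) _ _) (sym (cong₂ _-_ (⊗-at-suc f h n) (⊗-at-suc g h n)))))
    where
    lemma : ∀ a b c d e → (a + - b) * c + (d + - e) ≡ (a * c + d) + - (b * c + e)
    lemma = solve 5 (λ a b c d e → (a :+ (:- b)) :* c :+ (d :+ (:- e)) := (a :* c :+ d) :+ (:- (b :* c :+ e))) refl

  -- The recursion of ⊗-at-suc is asymmetric, so commutativity in degree n + 2 uses it in degrees n + 1 and n.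
  ⊗-comm : ∀ f g → f ⊗ g ≈ g ⊗ f
  ⊗-comm f g zero = trans (⊗-at-0 f g) (trans (ℤP.*-comm (f 0) (g 0)) (sym (⊗-at-0 g f)))
  ⊗-comm f g (suc zero) = begin
    (f ⊗ g) 1                      ≡⟨ ⊗-at-suc f g 0 ⟩
    f 0 * g 1 + (tail f ⊗ g) 0     ≡⟨ cong (f 0 * g 1 +_) (⊗-at-0 (tail f) g) ⟩
    f 0 * g 1 + f 1 * g 0          ≡⟨ ℤP.+-comm (f 0 * g 1) (f 1 * g 0) ⟩
    f 1 * g 0 + f 0 * g 1          ≡⟨ cong₂ _+_ (ℤP.*-comm (f 1) (g 0)) (ℤP.*-comm (f 0) (g 1)) ⟩
    g 0 * f 1 + g 1 * f 0          ≡⟨ cong (g 0 * f 1 +_) (⊗-at-0 (tail g) f) ⟨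
    g 0 * f 1 + (tail g ⊗ f) 0     ≡⟨ ⊗-at-suc g f 0 ⟨
    (g ⊗ f) 1                      ∎
    where open ≡-Reasoning
  ⊗-comm f g (suc (suc n)) = begin
    (f ⊗ g) (2 ℕ.+ n)                                          ≡⟨ ⊗-at-suc f g (suc n) ⟩
    x + (tail f ⊗ g) (suc n)                                   ≡⟨ cong (x +_) (⊗-comm (tail f) g (suc n)) ⟩
    x + (g ⊗ tail f) (suc n)                                   ≡⟨ cong (x +_) (⊗-at-suc g (tail f) n) ⟩
    x + (y + (tail g ⊗ tail f) n)                              ≡⟨ cong (λ z → x + (y + z)) (⊗-comm (tail g) (tail f) n) ⟩
    x + (y + (tail f ⊗ tail g) n)                              ≡⟨ swap x y _ ⟩
    y + (x + (tail f ⊗ tail g) n)                              ≡⟨ cong (y +_) (⊗-at-suc f (tail g) n) ⟨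
    y + (f ⊗ tail g) (suc n)                                   ≡⟨ cong (y +_) (⊗-comm f (tail g) (suc n)) ⟩
    y + (tail g ⊗ f) (suc n)                                   ≡⟨ ⊗-at-suc g f (suc n) ⟨
    (g ⊗ f) (2 ℕ.+ n)                                          ∎
    where
    open ≡-Reasoning
    x = f 0 * g (2 ℕ.+ n)
    y = g 0 * f (2 ℕ.+ n)
    swap : ∀ a b c → a + (b + c) ≡ b + (a + c)
    swap = solve 3 (λ a b c → a :+ (b :+ c) := b :+ (a :+ c)) refl

  ⊗-identityʳ : ∀ f → f ⊗ one ≈ f
  ⊗-identityʳ f n = trans (⊗-comm f one n) (⊗-identityˡ f n)

  ⊗-distribˡ-⊖ : ∀ f g h → f ⊗ (g ⊖ h) ≈ f ⊗ g ⊖ f ⊗ h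
  ⊗-distribˡ-⊖ f g h n = trans (⊗-comm f (g ⊖ h) n)
    (trans (⊗-distribʳ-⊖ g h f n) (cong₂ _-_ (⊗-comm g f n) (⊗-comm h f n)))

  ⊗-assoc : ∀ f g h → (f ⊗ g) ⊗ h ≈ f ⊗ (g ⊗ h)
  ⊗-assoc f g h zero = begin
    ((f ⊗ g) ⊗ h) 0     ≡⟨ trans (⊗-at-0 (f ⊗ g) h) (cong (_* h 0) (⊗-at-0 f g)) ⟩
    (f 0 * g 0) * h 0   ≡⟨ ℤP.*-assoc (f 0) (g 0) (h 0) ⟩
    f 0 * (g 0 * h 0)   ≡⟨ trans (⊗-at-0 f (g ⊗ h)) (cong (f 0 *_) (⊗-at-0 g h)) ⟨
    (f ⊗ (g ⊗ h)) 0     ∎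
    where open ≡-Reasoning
  ⊗-assoc f g h (suc n) = begin
    ((f ⊗ g) ⊗ h) (suc n)
      ≡⟨ ⊗-at-suc (f ⊗ g) h n ⟩
    (f ⊗ g) 0 * h (suc n) + (tail (f ⊗ g) ⊗ h) n
      ≡⟨ cong₂ _+_ (cong (_* h (suc n)) (⊗-at-0 f g)) (⊗-cong {g = h} (⊗-at-suc f g) (λ _ → refl) n) ⟩
    (f 0 * g 0) * h (suc n) + ((scale (f 0) (tail g) ⊕ tail f ⊗ g) ⊗ h) n
      ≡⟨ cong ((f 0 * g 0) * h (suc n) +_) (⊗-distribʳ-⊕ (scale (f 0) (tail g)) (tail f ⊗ g) h n) ⟩
    (f 0 * g 0) * h (suc n) + ((scale (f 0) (tail g) ⊗ h) n + ((tail f ⊗ g) ⊗ h) n)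
      ≡⟨ cong₂ (λ u v → (f 0 * g 0) * h (suc n) + (u + v)) (scale-⊗ (f 0) (tail g) h n) (⊗-assoc (tail f) g h n) ⟩
    (f 0 * g 0) * h (suc n) + (f 0 * (tail g ⊗ h) n + (tail f ⊗ (g ⊗ h)) n)
      ≡⟨ regroup (f 0) (g 0) (h (suc n)) _ _ ⟩
    f 0 * (g 0 * h (suc n) + (tail g ⊗ h) n) + (tail f ⊗ (g ⊗ h)) n
      ≡⟨ cong (λ u → f 0 * u + (tail f ⊗ (g ⊗ h)) n) (⊗-at-suc g h n) ⟨
    f 0 * (g ⊗ h) (suc n) + (tail f ⊗ (g ⊗ h)) n
      ≡⟨ ⊗-at-suc f (g ⊗ h) n ⟨
    (f ⊗ (g ⊗ h)) (suc n) ∎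
    where
    open ≡-Reasoning
    regroup : ∀ a b c d e → (a * b) * c + (a * d + e) ≡ a * (b * c + d) + e
    regroup = solve 5 (λ a b c d e → (a :* b) :* c :+ (a :* d :+ e) := a :* (b :* c :+ d) :+ e) refl

  ⊗-commutativeMonoid : CommutativeMonoid 0ℓ 0ℓ
  ⊗-commutativeMonoid = record
    { Carrier = PS
    ; _≈_ = _≈_
    ; _∙_ = _⊗_
    ; ε = one
    ; isCommutativeMonoid = record
      { isMonoid = record
        { isSemigroup = record
          { isMagma = record
            { isEquivalence = record
              { refl = λ _ → refl
              ; sym = λ f≈g n → sym (f≈g n)
              ; trans = λ f≈g g≈h n → trans (f≈g n) (g≈h n)
              }
            ; ∙-cong = ⊗-cong
            }
          ; assoc = ⊗-assoc
          }
        ; identity = ⊗-identityˡ , ⊗-identityʳ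
        }
      ; comm = ⊗-comm
      }
    }

  module ⊗-Solver = CommutativeMonoidSolver ⊗-commutativeMonoid

  mono-diag : ∀ c e → mono c e e ≡ c
  mono-diag c zero = refl
  mono-diag c (suc e) = mono-diag c e

  mono-off : ∀ c {e n} → e ≢ n → mono c e n ≡ 0ℤ
  mono-off c {zero} {zero} e≢n = ⊥-elim (e≢n refl)
  mono-off c {zero} {suc n} e≢n = refl
  mono-off c {suc e} {zero} e≢n = refl
  mono-off c {suc e} {suc n} e≢n = mono-off c (e≢n ∘ cong suc)

  shiftBy : ℕ → PS → PS
  shiftBy zero f n = f n
  shiftBy (suc e) f zero = 0ℤ
  shiftBy (suc e) f (suc n) = shiftBy e f n

  mono-⊗ : ∀ c e f → mono c e ⊗ f ≈ shiftBy e (scale c f)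
  mono-⊗ c zero f zero = ⊗-at-0 (mono c 0) f
  mono-⊗ c zero f (suc n) = trans (⊗-at-suc (mono c 0) f n)
    (trans (cong (c * f (suc n) +_) (⊗-zeroˡ f (λ _ → refl) n)) (ℤP.+-identityʳ _))
  mono-⊗ c (suc e) f zero = ⊗-at-0 (mono c (suc e)) f
  mono-⊗ c (suc e) f (suc n) = trans (⊗-at-suc (mono c (suc e)) f n) (trans (ℤP.+-identityˡ _) (mono-⊗ c e f n))

  mono-mono : ∀ e e′ → mono 1ℤ e ⊗ mono 1ℤ e′ ≈ mono 1ℤ (e ℕ.+ e′)
  mono-mono e e′ n = trans (mono-⊗ 1ℤ e (mono 1ℤ e′) n) (shift-mono e n)
    where
    shift-mono : ∀ e n → shiftBy e (scale 1ℤ (mono 1ℤ e′)) n ≡ mono 1ℤ (e ℕ.+ e′) n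
    shift-mono zero n = ℤP.*-identityˡ (mono 1ℤ e′ n)
    shift-mono (suc e) zero = refl
    shift-mono (suc e) (suc n) = shift-mono e n

  mono-≈[]-zero : ∀ c {e N} → N < e → mono c e ≈[ N ] zeroPS
  mono-≈[]-zero c N<e i i≤N = mono-off c (λ e≡i → ℕP.<⇒≢ (ℕP.≤-<-trans i≤N N<e) (sym e≡i))

  one-⊖-≈[]-one : ∀ c {e N} → N < e → one ⊖ mono c e ≈[ N ] one
  one-⊖-≈[]-one c N<e i i≤N = trans (cong (λ x → one i - x) (mono-≈[]-zero c N<e i i≤N)) (ℤP.+-identityʳ (one i))

  inv1-at-suc : ∀ f n → inv1 f (suc n) ≡ - (tail f ⊗ inv1 f) n
  inv1-at-suc f n = cong (λ l → - sumℤ l)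
    (trans (cong (zipWith _*_ (map (f ∘ suc) (upTo (suc n)))) (invList-≡ n))
           (zipWith-map (upTo (suc n))))
    where
    invList-≡ : ∀ n → invList f n ≡ map (λ j → inv1 f (n ℕ.∸ j)) (upTo (suc n))
    invList-≡ zero = refl
    invList-≡ (suc n) = trans (cong (inv1 f (suc n) ∷_) (invList-≡ n))
      (sym (map-upTo-suc (λ j → inv1 f (suc n ℕ.∸ j)) (suc n)))
    zipWith-map : ∀ (is : List ℕ) →
      zipWith _*_ (map (f ∘ suc) is) (map (λ j → inv1 f (n ℕ.∸ j)) is) ≡ map (λ i → f (suc i) * inv1 f (n ℕ.∸ i)) is
    zipWith-map Data.List.[] = refl
    zipWith-map (i ∷ is) = cong (_ ∷_) (zipWith-map is)

  inv1-inverseʳ : ∀ f → f 0 ≡ 1ℤ → f ⊗ inv1 f ≈ one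
  inv1-inverseʳ f f₀≡1 zero = trans (⊗-at-0 f (inv1 f)) (cong (_* 1ℤ) f₀≡1)
  inv1-inverseʳ f f₀≡1 (suc n) = trans (⊗-at-suc f (inv1 f) n)
    (trans (cong (_+ (tail f ⊗ inv1 f) n) (trans (cong₂ _*_ f₀≡1 (inv1-at-suc f n)) (ℤP.*-identityˡ _)))
           (ℤP.+-inverseˡ ((tail f ⊗ inv1 f) n)))

  inv1-cong[] : ∀ {f f′} N → f ≈[ N ] f′ → inv1 f ≈[ N ] inv1 f′
  inv1-cong[] zero _ zero _ = refl
  inv1-cong[] {f} {f′} (suc N) f≈f′ i i≤1+N with ℕP.m≤n⇒m<n∨m≡n i≤1+N
  ... | inj₁ (s≤s i≤N) = inv1-cong[] N f≈f′↾N i i≤N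
    where
    f≈f′↾N : f ≈[ N ] f′
    f≈f′↾N j j≤N = f≈f′ j (ℕP.m≤n⇒m≤1+n j≤N)
  ... | inj₂ refl = begin
    inv1 f (suc N)              ≡⟨ inv1-at-suc f N ⟩
    - (tail f ⊗ inv1 f) N       ≡⟨ cong -_ (⊗-cong[] (λ j j≤N → f≈f′ (suc j) (s≤s j≤N))
                                                      (inv1-cong[] N (λ j j≤N → f≈f′ j (ℕP.m≤n⇒m≤1+n j≤N)))
                                                      N ℕP.≤-refl) ⟩
    - (tail f′ ⊗ inv1 f′) N     ≡⟨ inv1-at-suc f′ N ⟨
    inv1 f′ (suc N)             ∎
    where open ≡-Reasoning

  prodF-cong : ∀ {f g} L → (∀ i → i < L → f i ≈ g i) → prodF f L ≈ prodF g L
  prodF-cong zero _ _ = refl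
  prodF-cong (suc L) f≈g = ⊗-cong (prodF-cong L (λ i i<L → f≈g i (ℕP.m<n⇒m<1+n i<L))) (f≈g L ℕP.≤-refl)

  prodF-one : ∀ L → prodF (λ _ → one) L ≈ one
  prodF-one zero _ = refl
  prodF-one (suc L) n = trans (⊗-identityʳ (prodF (λ _ → one) L) n) (prodF-one L n)

  prodF-⊗ : ∀ f g L → prodF (λ i → f i ⊗ g i) L ≈ prodF f L ⊗ prodF g L
  prodF-⊗ f g zero n = sym (⊗-identityˡ one n)
  prodF-⊗ f g (suc L) n = trans (⊗-cong {g = f L ⊗ g L} (prodF-⊗ f g L) (λ _ → refl) n)
    (⊗-Solver.solve 4 (λ a b c d → (a ⊕′ b) ⊕′ (c ⊕′ d) ⊜ (a ⊕′ c) ⊕′ (b ⊕′ d)) (λ _ → refl)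
      (prodF f L) (prodF g L) (f L) (g L) n)
    where open ⊗-Solver using (_⊜_) renaming (_⊕_ to _⊕′_)

  prodF-factorAt : ∀ {f g} Y t L → t < L → (∀ i → i < L → i ≢ t → f i ≈ g i) → f t ≈ g t ⊗ Y →
    prodF f L ≈ prodF g L ⊗ Y
  prodF-factorAt {f} {g} Y t (suc L) t<1+L f≈g ft≈gtY with ℕP.m≤n⇒m<n∨m≡n (ℕP.≤-pred t<1+L)
  ... | inj₁ t<L = λ n → trans
    (⊗-cong (prodF-factorAt Y t L t<L (λ i i<L → f≈g i (ℕP.m<n⇒m<1+n i<L)) ft≈gtY)
            (f≈g L ℕP.≤-refl (λ L≡t → ℕP.<⇒≢ t<L (sym L≡t))) n)
    (⊗-Solver.solve 3 (λ x y z → (x ⊕′ y) ⊕′ z ⊜ (x ⊕′ z) ⊕′ y) (λ _ → refl) (prodF g L) Y (g L) n)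
    where open ⊗-Solver using (_⊜_) renaming (_⊕_ to _⊕′_)
  ... | inj₂ refl = λ n → trans
    (⊗-cong (prodF-cong t (λ i i<t → f≈g i (ℕP.m<n⇒m<1+n i<t) (ℕP.<⇒≢ i<t))) ft≈gtY n)
    (sym (⊗-assoc (prodF g t) (g t) Y n))

  poch-at-0 : ∀ c {s} d K → 1 ≤ s → poch c s d K 0 ≡ 1ℤ
  poch-at-0 c d zero _ = refl
  poch-at-0 c {s} d (suc K) 1≤s = begin
    poch c s d (suc K) 0                                   ≡⟨ ⊗-at-0 (poch c s d K) (one ⊖ mono c (s ℕ.+ d ℕ.* K)) ⟩
    poch c s d K 0 * (one ⊖ mono c (s ℕ.+ d ℕ.* K)) 0      ≡⟨ cong₂ _*_ (poch-at-0 c d K 1≤s)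
                                                                (one-⊖-≈[]-one c (ℕP.≤-trans 1≤s (ℕP.m≤m+n s (d ℕ.* K))) 0 z≤n) ⟩
    1ℤ * 1ℤ                                                ∎
    where open ≡-Reasoning

  -- The factors of (c q; q)_∞ beyond the K-th are ≡ 1 modulo q^(K+1).
  pochInf-≈[] : ∀ c {N} K → N < K → pochInf c 1 1 ≈[ N ] poch c 1 1 K
  pochInf-≈[] c K N<K i i≤N = sym (stable K (ℕP.≤-<-trans i≤N N<K))
    where
    stable : ∀ K → i < K → poch c 1 1 K i ≡ poch c 1 1 (suc i) i
    stable (suc K) i<1+K with ℕP.m≤n⇒m<n∨m≡n (ℕP.≤-pred i<1+K)
    ... | inj₂ refl = refl
    ... | inj₁ i<K = trans
      (⊗-cong[] {poch c 1 1 K} {g = one ⊖ mono c (1 ℕ.+ 1 ℕ.* K)} (λ _ _ → refl) (one-⊖-≈[]-one c i<e) i ℕP.≤-refl)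
      (trans (⊗-identityʳ (poch c 1 1 K) i) (stable K i<K))
      where
      i<e : i < 1 ℕ.+ 1 ℕ.* K
      i<e = s≤s (ℕP.≤-trans (ℕP.<⇒≤ i<K) (ℕP.≤-reflexive (sym (ℕP.*-identityˡ K))))

  prodF-cong[] : ∀ {f g N} L → (∀ i → i < L → f i ≈[ N ] g i) → prodF f L ≈[ N ] prodF g L
  prodF-cong[] zero _ _ _ = refl
  prodF-cong[] (suc L) f≈g = ⊗-cong[] (prodF-cong[] L (λ i i<L → f≈g i (ℕP.m<n⇒m<1+n i<L))) (f≈g L ℕP.≤-refl)

  ≈[]-divide : ∀ {f g u N} → u 0 ≡ 1ℤ → f ⊗ u ≈[ N ] g → f ≈[ N ] g ⊗ inv1 u
  ≈[]-divide {f} {g} {u} u₀≡1 fu≈g i i≤N = begin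
    f i                         ≡⟨ ⊗-identityʳ f i ⟨
    (f ⊗ one) i                 ≡⟨ ⊗-cong {f} (λ _ → refl) (inv1-inverseʳ u u₀≡1) i ⟨
    (f ⊗ (u ⊗ inv1 u)) i        ≡⟨ ⊗-assoc f u (inv1 u) i ⟨
    ((f ⊗ u) ⊗ inv1 u) i        ≡⟨ ⊗-cong[] {g = inv1 u} fu≈g (λ _ _ → refl) i i≤N ⟩
    (g ⊗ inv1 u) i              ∎
    where open ≡-Reasoning

  geometric : ℕ → ℕ → PS
  geometric s zero = zeroPS
  geometric s (suc R) = geometric s R ⊕ mono 1ℤ (s ℕ.* R)

  P⁻ P⁺ : ℕ → PS
  P⁻ s = one ⊖ mono 1ℤ s
  P⁺ s = one ⊖ mono (- 1ℤ) s

  P⁺≈one⊕mono : ∀ s → one ⊕ mono 1ℤ s ≈ P⁺ s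
  P⁺≈one⊕mono s i with s ℕ.≡ᵇ i
  ... | true = refl
  ... | false = refl

  mono-⊗-P⁻ : ∀ e s → mono 1ℤ e ⊗ P⁻ s ≈ mono 1ℤ e ⊖ mono 1ℤ (e ℕ.+ s)
  mono-⊗-P⁻ e s i = trans (⊗-distribˡ-⊖ (mono 1ℤ e) one (mono 1ℤ s) i)
    (cong₂ _-_ (⊗-identityʳ (mono 1ℤ e) i) (mono-mono e s i))

  geometric-⊗-P⁻ : ∀ s R → geometric s R ⊗ P⁻ s ≈ one ⊖ mono 1ℤ (s ℕ.* R)
  geometric-⊗-P⁻ s zero i = begin
    (zeroPS ⊗ P⁻ s) i               ≡⟨ ⊗-zeroˡ (P⁻ s) (λ _ → refl) i ⟩
    0ℤ                              ≡⟨ ℤP.+-inverseʳ (one i) ⟨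
    one i - one i                 ≡⟨ cong (λ e → one i - mono 1ℤ e i) (ℕP.*-zeroʳ s) ⟨
    one i - mono 1ℤ (s ℕ.* 0) i     ∎
    where open ≡-Reasoning
  geometric-⊗-P⁻ s (suc R) i = begin
    ((geometric s R ⊕ mono 1ℤ (s ℕ.* R)) ⊗ P⁻ s) i
      ≡⟨ ⊗-distribʳ-⊕ (geometric s R) (mono 1ℤ (s ℕ.* R)) (P⁻ s) i ⟩
    (geometric s R ⊗ P⁻ s) i + (mono 1ℤ (s ℕ.* R) ⊗ P⁻ s) i
      ≡⟨ cong₂ _+_ (geometric-⊗-P⁻ s R i) (mono-⊗-P⁻ (s ℕ.* R) s i) ⟩
    (one i - mono 1ℤ (s ℕ.* R) i) + (mono 1ℤ (s ℕ.* R) i - mono 1ℤ (s ℕ.* R ℕ.+ s) i)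
      ≡⟨ telescope (one i) (mono 1ℤ (s ℕ.* R) i) (mono 1ℤ (s ℕ.* R ℕ.+ s) i) ⟩
    one i - mono 1ℤ (s ℕ.* R ℕ.+ s) i
      ≡⟨ cong (λ e → one i - mono 1ℤ e i) (trans (ℕP.+-comm (s ℕ.* R) s) (sym (ℕP.*-suc s R))) ⟩
    one i - mono 1ℤ (s ℕ.* suc R) i ∎
    where
    open ≡-Reasoning
    telescope : ∀ x y z → (x + - y) + (y + - z) ≡ x + - z
    telescope = solve 3 (λ x y z → (x :+ (:- y)) :+ (y :+ (:- z)) := x :+ (:- z)) refl

  -- The i-th factor of a product over i < L belongs to the size i + 1.
  prodF-factorAtSize : ∀ {f g} Y {M} L → 1 ≤ M → M ≤ L → (∀ i → suc i ≢ M → f i ≈ g i) → (∀ i → suc i ≡ M → f i ≈ g i ⊗ Y) →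
    prodF f L ≈ prodF g L ⊗ Y
  prodF-factorAtSize Y {suc t} L (s≤s z≤n) M≤L f≈g f≈gY =
    prodF-factorAt Y t L M≤L (λ i _ i≢t → f≈g i (i≢t ∘ ℕP.suc-injective)) (f≈gY t refl)

module GeneratingFunctions where

  open PowerSeries
  open import Data.Nat as ℕ using (ℕ; zero; suc; _+_; _*_; _∸_; _≤_; _<_; z≤n; s≤s)
  import Data.Nat.Properties as ℕP
  open import Data.Integer as ℤ using (+_; 1ℤ)
  import Data.Integer.Properties as ℤP
  open import Data.List using ([]; _∷_; map; upTo)
  import Data.List.Properties as ListP
  open import Data.Bool using (Bool; true; false; T; if_then_else_)
  open import Data.Unit using (⊤; tt)
  open import Data.Empty using (⊥; ⊥-elim)
  open import Data.Fin using (Fin)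
  open import Data.Fin.Properties using (+↔⊎; *↔×; 1↔⊤)
  open import Data.Product using (Σ; _×_; _,_; proj₁; proj₂)
  open import Data.Product.Function.NonDependent.Propositional using (_×-↔_)
  open import Data.Sum using (_⊎_; inj₁; inj₂; [_,_])
  open import Data.Sum.Function.Propositional using (_⊎-↔_)
  open import Function using (_∘_)
  open import Function.Bundles using (_↔_; mk↔ₛ′; Inverse)
  open import Function.Properties.Inverse using (↔-refl; ↔-trans)
  open import Relation.Nullary using (¬_; yes; no)
  open import Relation.Binary.PropositionalEquality hiding ([_])

  Level : {C : Set} → (C → ℕ) → ℕ → Set
  Level {C} w n = Σ C λ x → w x ≡ n

  Level-≡ : ∀ {C : Set} {w : C → ℕ} {n} {x y : C} {p : w x ≡ n} {q : w y ≡ n} → x ≡ y →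
    _≡_ {A = Level w n} (x , p) (y , q)
  Level-≡ refl = cong (_ ,_) (ℕP.≡-irrelevant _ _)

  HasGF : {C : Set} → (C → ℕ) → PS → Set
  HasGF w f = ∀ n → Σ ℕ λ c → (Fin c ↔ Level w n) × (+ c ≡ f n)

  HasGF-↔ : ∀ {C D : Set} {w : C → ℕ} {w′ : D → ℕ} {f} (φ : C ↔ D) → (∀ x → w′ (Inverse.to φ x) ≡ w x) →
    HasGF w f → HasGF w′ f
  HasGF-↔ {w = w} {w′} φ w′∘φ≡w gf n = let c , ψ , c≡ = gf n in c , ↔-trans ψ level↔ , c≡
    where
    open Inverse φ renaming (to to φ→; from to φ←)
    level↔ : Level w n ↔ Level w′ n
    level↔ = mk↔ₛ′ (λ (x , p) → φ→ x , trans (w′∘φ≡w x) p)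
                   (λ (y , q) → φ← y , trans (sym (w′∘φ≡w (φ← y))) (trans (cong w′ (strictlyInverseˡ y)) q))
                   (λ (y , _) → Level-≡ (strictlyInverseˡ y))
                   (λ (x , _) → Level-≡ (strictlyInverseʳ x))

  Fin0↔ : ∀ {X : Set} → ¬ X → Fin 0 ↔ X
  Fin0↔ ¬x = mk↔ₛ′ (λ ()) (⊥-elim ∘ ¬x) (⊥-elim ∘ ¬x) (λ ())

  HasGF-⊥ : ∀ {w : ⊥ → ℕ} → HasGF w zeroPS
  HasGF-⊥ n = 0 , Fin0↔ (λ ()) , refl

  HasGF-⊤ : ∀ e → HasGF (λ (_ : ⊤) → e) (mono 1ℤ e)
  HasGF-⊤ e n with e ℕ.≟ n
  ... | yes refl = 1 , ↔-trans 1↔⊤ (mk↔ₛ′ (λ _ → tt , refl) (λ _ → tt) (λ _ → Level-≡ refl) (λ _ → refl)) ,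
                   sym (mono-diag 1ℤ e)
  ... | no e≢n = 0 , Fin0↔ (λ (_ , e≡n) → e≢n e≡n) , sym (mono-off 1ℤ e≢n)

  HasGF-⊎ : ∀ {C D : Set} {w : C → ℕ} {w′ : D → ℕ} {f g} → HasGF w f → HasGF w′ g → HasGF [ w , w′ ] (f ⊕ g)
  HasGF-⊎ {w = w} {w′} gf gg n =
    let c , φ , c≡ = gf n ; d , ψ , d≡ = gg n in
    c + d , ↔-trans +↔⊎ (↔-trans (φ ⊎-↔ ψ) level↔) , trans (ℤP.pos-+ c d) (cong₂ ℤ._+_ c≡ d≡)
    where
    level↔ : (Level w n ⊎ Level w′ n) ↔ Level [ w , w′ ] n
    level↔ = mk↔ₛ′ [ (λ (x , p) → inj₁ x , p) , (λ (y , q) → inj₂ y , q) ]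
                   (λ { (inj₁ x , p) → inj₁ (x , p) ; (inj₂ y , q) → inj₂ (y , q) })
                   (λ { (inj₁ x , p) → refl ; (inj₂ y , q) → refl })
                   (λ { (inj₁ _) → refl ; (inj₂ _) → refl })

  Fin-sum↔Σ : ∀ k (h : ℕ → ℕ) (X : ℕ → Set) → (∀ i → Fin (h i) ↔ X i) →
    Fin (sumℕ (map h (upTo k))) ↔ Σ ℕ (λ i → i < k × X i)
  Fin-sum↔Σ zero h X φ = mk↔ₛ′ (λ ()) (λ ()) (λ ()) (λ ())
  Fin-sum↔Σ (suc k) h X φ =
    ↔-trans (subst (λ l → Fin (sumℕ (map h (upTo (suc k)))) ↔ Fin (sumℕ l)) (map-upTo-suc h k) ↔-refl)
    (↔-trans +↔⊎ (↔-trans (φ 0 ⊎-↔ Fin-sum↔Σ k (h ∘ suc) (X ∘ suc) (φ ∘ suc)) split↔))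
    where
    split↔ : (X 0 ⊎ Σ ℕ (λ i → i < k × X (suc i))) ↔ Σ ℕ (λ i → i < suc k × X i)
    split↔ = mk↔ₛ′ [ (λ x → 0 , s≤s z≤n , x) , (λ (i , i<k , x) → suc i , s≤s i<k , x) ]
                   (λ { (zero , _ , x) → inj₁ x ; (suc i , s≤s i<k , x) → inj₂ (i , i<k , x) })
                   (λ { (zero , s≤s z≤n , x) → refl ; (suc i , s≤s i<k , x) → refl })
                   (λ { (inj₁ _) → refl ; (inj₂ _) → refl })

  HasGF-× : ∀ {C D : Set} {w : C → ℕ} {w′ : D → ℕ} {f g} → HasGF w f → HasGF w′ g →
    HasGF (λ (x , y) → w x + w′ y) (f ⊗ g)
  HasGF-× {w = w} {w′} {f} {g} gf gg n =
    sumℕ (map term (upTo (suc n))) ,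
    ↔-trans (Fin-sum↔Σ (suc n) term (λ i → Level w i × Level w′ (n ∸ i))
              (λ i → ↔-trans *↔× (proj₁ (proj₂ (gf i)) ×-↔ proj₁ (proj₂ (gg (n ∸ i))))))
            level↔ ,
    trans (pos-sum (upTo (suc n))) (cong sumℤ (ListP.map-cong term≡ (upTo (suc n))))
    where
    term : ℕ → ℕ
    term i = proj₁ (gf i) * proj₁ (gg (n ∸ i))
    term≡ : ∀ i → + term i ≡ f i ℤ.* g (n ∸ i)
    term≡ i = trans (ℤP.pos-* (proj₁ (gf i)) (proj₁ (gg (n ∸ i))))
                    (cong₂ ℤ._*_ (proj₂ (proj₂ (gf i))) (proj₂ (proj₂ (gg (n ∸ i)))))
    pos-sum : ∀ is → + sumℕ (map term is) ≡ sumℤ (map (λ i → + term i) is)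
    pos-sum [] = refl
    pos-sum (i ∷ is) = trans (ℤP.pos-+ (term i) _) (cong (λ z → + term i ℤ.+ z) (pos-sum is))
    level↔ : Σ ℕ (λ i → i < suc n × Level w i × Level w′ (n ∸ i)) ↔ Level (λ (x , y) → w x + w′ y) n
    level↔ = mk↔ₛ′
      (λ { (i , s≤s i≤n , (x , p) , (y , q)) → (x , y) , trans (cong₂ _+_ p q) (ℕP.m+[n∸m]≡n i≤n) })
      (λ ((x , y) , p) → w x , s≤s (subst (w x ≤_) p (ℕP.m≤m+n (w x) (w′ y))) , (x , refl) ,
                         (y , trans (sym (ℕP.m+n∸m≡n (w x) (w′ y))) (cong (_∸ w x) p)))
      (λ _ → Level-≡ refl)
      (λ { (i , s≤s i≤n , (x , refl) , (y , q)) →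
           cong₂ (λ lt q′ → w x , lt , (x , refl) , q′) (ℕP.≤-irrelevant _ _) (Level-≡ refl) })

  indicator : Bool → ℕ → PS
  indicator b e = if b then mono 1ℤ e else zeroPS

  HasGF-T : ∀ b e → HasGF (λ (_ : T b) → e) (indicator b e)
  HasGF-T true e = HasGF-⊤ e
  HasGF-T false e = HasGF-⊥

  HasGF-overlined : ∀ (al : Bool → Bool) s →
    HasGF (λ ((b , _) : Σ Bool (T ∘ al)) → if b then s else 0) (indicator (al false) 0 ⊕ indicator (al true) s)
  HasGF-overlined al s = HasGF-↔ Σ-Bool↔ (λ { (inj₁ _) → refl ; (inj₂ _) → refl })
    (HasGF-⊎ (HasGF-T (al false) 0) (HasGF-T (al true) s))
    where
    Σ-Bool↔ : (T (al false) ⊎ T (al true)) ↔ Σ Bool (T ∘ al)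
    Σ-Bool↔ = mk↔ₛ′ [ (false ,_) , (true ,_) ] (λ { (false , t) → inj₁ t ; (true , t) → inj₂ t })
                    (λ { (false , _) → refl ; (true , _) → refl }) (λ { (inj₁ _) → refl ; (inj₂ _) → refl })

  HasGF-plain : ∀ s R → HasGF (λ ((j , _) : Σ ℕ (_< R)) → s * j) (geometric s R)
  HasGF-plain s zero = HasGF-↔ {w = λ ()} (mk↔ₛ′ (λ ()) (λ ()) (λ ()) (λ ())) (λ ()) HasGF-⊥
  HasGF-plain s (suc R) = HasGF-↔ last↔ (λ { (inj₁ _) → refl ; (inj₂ _) → refl })
    (HasGF-⊎ (HasGF-plain s R) (HasGF-⊤ (s * R)))
    where
    last↔ : (Σ ℕ (_< R) ⊎ ⊤) ↔ Σ ℕ (_< suc R)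
    last↔ = mk↔ₛ′ to from to∘from from∘to
      where
      to : Σ ℕ (_< R) ⊎ ⊤ → Σ ℕ (_< suc R)
      to = [ (λ (j , j<R) → j , ℕP.m<n⇒m<1+n j<R) , (λ _ → R , ℕP.≤-refl) ]
      from : Σ ℕ (_< suc R) → Σ ℕ (_< R) ⊎ ⊤
      from (j , j<1+R) with j ℕ.<? R
      ... | yes j<R = inj₁ (j , j<R)
      ... | no _ = inj₂ tt
      to∘from : ∀ x → to (from x) ≡ x
      to∘from (j , j<1+R) with j ℕ.<? R
      ... | yes _ = cong (j ,_) (ℕP.≤-irrelevant _ _)
      ... | no j≮R with ℕP.≤-antisym (ℕP.≤-pred j<1+R) (ℕP.≮⇒≥ j≮R)
      ...   | refl = cong (j ,_) (ℕP.≤-irrelevant _ _)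
      from∘to : ∀ y → from (to y) ≡ y
      from∘to (inj₁ (j , j<R)) with j ℕ.<? R
      ... | yes _ = cong (λ lt → inj₁ (j , lt)) (ℕP.≤-irrelevant _ _)
      ... | no j≮R = ⊥-elim (j≮R j<R)
      from∘to (inj₂ tt) with R ℕ.<? R
      ... | yes R<R = ⊥-elim (ℕP.<-irrefl refl R<R)
      ... | no _ = refl

module PartLists where

  open import Data.Nat as ℕ using (ℕ; zero; suc; _+_; _*_; _≤_; z≤n; s≤s; _≡ᵇ_)
  import Data.Nat.Properties as ℕP
  open import Data.Bool using (Bool; true; false; _∧_; _∨_; not; if_then_else_; T)
  import Data.Bool.Properties as BoolP
  open import Data.List as List using (List; []; _∷_; _++_; map; replicate; foldr; length)
  open import Data.List.Relation.Unary.All as All using (All; []; _∷_)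
  import Data.List.Relation.Unary.All.Properties as AllP
  open import Data.List.Relation.Unary.Any as Any using (Any; here; there)
  open import Data.List.Relation.Unary.Any.Properties using (lookup-index)
  open import Data.List.Membership.Propositional using (_∈_)
  open import Data.List.Relation.Unary.Linked as Linked using (Linked; []; [-]; _∷_; _∷′_)
  import Data.Maybe as Maybe
  open import Data.Maybe.Relation.Binary.Connected using (Connected; just; just-nothing)
  open import Data.Product using (_×_; _,_; proj₁; proj₂; map₁)
  open import Data.Sum using (inj₁; inj₂)
  open import Data.Unit using (tt)
  open import Data.Empty using (⊥-elim)
  open import Data.Fin using (Fin)
  import Data.Fin.Properties as FinP
  open import Function using (_∘_)
  open import Function.Bundles using (Equivalence; _⇔_; mk⇔)
  open import Relation.Nullary using (¬_; yes; no; contradiction)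
  open import Relation.Nullary.Decidable using (dec-true; dec-false)
  open import Relation.Binary.PropositionalEquality

  ≡ᵇ-refl : ∀ n → (n ≡ᵇ n) ≡ true
  ≡ᵇ-refl n = dec-true (n ℕ.≟ n) refl

  ≡ᵇ-≢ : ∀ {m n} → m ≢ n → (m ≡ᵇ n) ≡ false
  ≡ᵇ-≢ {m} {n} = dec-false (m ℕ.≟ n)

  ¬T⇒≡false : ∀ {b} → ¬ T b → b ≡ false
  ¬T⇒≡false {true} ¬t = contradiction tt ¬t
  ¬T⇒≡false {false} _ = refl

  not-∨⇔→ : ∀ c o → T (not c ∨ o) ⇔ (T c → T o)
  not-∨⇔→ true o = mk⇔ (λ t _ → t) (λ f → f tt)
  not-∨⇔→ false o = mk⇔ (λ _ ()) (λ _ → tt)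

  Bounded : ℕ → List Part → Set
  Bounded L = All (λ p → proj₁ p ≤ L)

  Valid : List Part → Set
  Valid xs = All (λ p → 1 ≤ proj₁ p) xs × Linked _Follows_ xs

  toOverpartition : (xs : List Part) → Valid xs → Overpartition
  toOverpartition xs (pos , ord) = mkOP xs pos ord

  valid : (π : Overpartition) → Valid (parts π)
  valid π = positive π , ordered π

  Follows-irrelevant : ∀ {x y} (p q : x Follows y) → p ≡ q
  Follows-irrelevant (inj₁ p) (inj₁ q) = cong inj₁ (ℕP.≤-irrelevant p q)
  Follows-irrelevant (inj₁ p) (inj₂ (refl , _)) = ⊥-elim (ℕP.<-irrefl refl p)
  Follows-irrelevant (inj₂ (refl , _)) (inj₁ q) = ⊥-elim (ℕP.<-irrefl refl q)
  Follows-irrelevant (inj₂ (refl , refl)) (inj₂ (refl , refl)) = refl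

  Overpartition-≡ : ∀ {π π′} → parts π ≡ parts π′ → π ≡ π′
  Overpartition-≡ {mkOP xs p l} {mkOP .xs p′ l′} refl =
    cong₂ (mkOP xs) (All.irrelevant ℕP.≤-irrelevant p p′) (Linked.irrelevant (λ {x} {y} → Follows-irrelevant {x} {y}) l l′)

  Follows⇒≤ : ∀ {x y} → x Follows y → proj₁ y ≤ proj₁ x
  Follows⇒≤ (inj₁ y<x) = ℕP.<⇒≤ y<x
  Follows⇒≤ (inj₂ (y≡x , _)) = ℕP.≤-reflexive y≡x

  linked⇒bounded : ∀ {L x xs} → Linked _Follows_ (x ∷ xs) → proj₁ x ≤ L → Bounded L (x ∷ xs)
  linked⇒bounded [-] x≤L = x≤L ∷ []
  linked⇒bounded {x = x} {y ∷ _} (x→y ∷ l) x≤L = x≤L ∷ linked⇒bounded l (ℕP.≤-trans (Follows⇒≤ {x} {y} x→y) x≤L)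

  hasOverlinedₗ : ℕ → List Part → Bool
  hasOverlinedₗ m = foldr (λ p acc → ((proj₁ p ≡ᵇ m) ∧ proj₂ p) ∨ acc) false

  nonOverCountₗ : ℕ → List Part → ℕ
  nonOverCountₗ m = foldr (λ p acc → if (proj₁ p ≡ᵇ m) ∧ not (proj₂ p) then suc acc else acc) 0

  weightₗ : List Part → ℕ
  weightₗ xs = sumℕ (map proj₁ xs)

  overlinedPart : ℕ → Bool → List Part
  overlinedPart s true = (s , true) ∷ []
  overlinedPart s false = []

  plainParts : ℕ → ℕ → List Part
  plainParts s j = replicate j (s , false)

  consBlock : ℕ → Bool × ℕ × List Part → List Part
  consBlock s (b , j , rest) = overlinedPart s b ++ (plainParts s j ++ rest)

  blockWeight : ℕ → Bool → ℕ → ℕ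
  blockWeight s b j = (if b then s else 0) + s * j

  -- In a valid list with parts ≤ s, the parts of size s form a prefix, with (s , true) first if present.
  stripPlain : ℕ → List Part → ℕ × List Part
  stripPlain s [] = 0 , []
  stripPlain s ((t , true) ∷ xs) = 0 , (t , true) ∷ xs
  stripPlain s ((t , false) ∷ xs) with t ℕ.≟ s
  ... | yes _ = map₁ suc (stripPlain s xs)
  ... | no _ = 0 , (t , false) ∷ xs

  splitBlock : ℕ → List Part → Bool × ℕ × List Part
  splitBlock s [] = false , 0 , []
  splitBlock s ((t , false) ∷ xs) = false , stripPlain s ((t , false) ∷ xs)
  splitBlock s ((t , true) ∷ xs) with t ℕ.≟ s
  ... | yes _ = true , stripPlain s xs
  ... | no _ = false , 0 , (t , true) ∷ xs

  plainParts-stripPlain : ∀ s xs → plainParts s (proj₁ (stripPlain s xs)) ++ proj₂ (stripPlain s xs) ≡ xs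
  plainParts-stripPlain s [] = refl
  plainParts-stripPlain s ((t , true) ∷ xs) = refl
  plainParts-stripPlain s ((t , false) ∷ xs) with t ℕ.≟ s
  ... | yes refl = cong ((t , false) ∷_) (plainParts-stripPlain t xs)
  ... | no _ = refl

  consBlock-splitBlock : ∀ s xs → consBlock s (splitBlock s xs) ≡ xs
  consBlock-splitBlock s [] = refl
  consBlock-splitBlock s ((t , false) ∷ xs) = plainParts-stripPlain s ((t , false) ∷ xs)
  consBlock-splitBlock s ((t , true) ∷ xs) with t ℕ.≟ s
  ... | yes refl = cong ((t , true) ∷_) (plainParts-stripPlain t xs)
  ... | no _ = refl

  stripPlain-plainParts : ∀ {L} j rest → Bounded L rest → stripPlain (suc L) (plainParts (suc L) j ++ rest) ≡ (j , rest)
  stripPlain-plainParts {L} (suc j) rest bnd with suc L ℕ.≟ suc L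
  ... | yes _ = cong (map₁ suc) (stripPlain-plainParts j rest bnd)
  ... | no L≢L = ⊥-elim (L≢L refl)
  stripPlain-plainParts zero [] bnd = refl
  stripPlain-plainParts zero ((t , true) ∷ rest) bnd = refl
  stripPlain-plainParts {L} zero ((t , false) ∷ rest) (t≤L ∷ _) with t ℕ.≟ suc L
  ... | yes refl = ⊥-elim (ℕP.<-irrefl refl t≤L)
  ... | no _ = refl

  splitBlock-consBlock : ∀ {L} b j rest → Bounded L rest → splitBlock (suc L) (consBlock (suc L) (b , j , rest)) ≡ (b , j , rest)
  splitBlock-consBlock {L} true j rest bnd with suc L ℕ.≟ suc L
  ... | yes _ = cong (true ,_) (stripPlain-plainParts j rest bnd)
  ... | no L≢L = ⊥-elim (L≢L refl)
  splitBlock-consBlock false (suc j) rest bnd = cong (false ,_) (stripPlain-plainParts (suc j) rest bnd)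
  splitBlock-consBlock false zero [] bnd = refl
  splitBlock-consBlock false zero ((t , false) ∷ rest) bnd = cong (false ,_) (stripPlain-plainParts 0 ((t , false) ∷ rest) bnd)
  splitBlock-consBlock {L} false zero ((t , true) ∷ rest) (t≤L ∷ _) with t ℕ.≟ suc L
  ... | yes refl = ⊥-elim (ℕP.<-irrefl refl t≤L)
  ... | no _ = refl

  stripPlain-bounded : ∀ {L} o xs → Linked _Follows_ ((suc L , o) ∷ xs) → Bounded L (proj₂ (stripPlain (suc L) xs))
  stripPlain-bounded o [] _ = []
  stripPlain-bounded o ((t , true) ∷ xs) (inj₁ t≤L ∷ l) = linked⇒bounded l (ℕP.≤-pred t≤L)
  stripPlain-bounded {L} o ((t , false) ∷ xs) (t→ ∷ l) with t ℕ.≟ suc L | t→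
  ... | yes refl | _ = stripPlain-bounded false xs l
  ... | no _ | inj₁ t≤L = linked⇒bounded l (ℕP.≤-pred t≤L)
  ... | no t≢s | inj₂ (t≡s , _) = ⊥-elim (t≢s t≡s)

  splitBlock-bounded : ∀ {L} xs → Linked _Follows_ xs → Bounded (suc L) xs → Bounded L (proj₂ (proj₂ (splitBlock (suc L) xs)))
  splitBlock-bounded [] _ _ = []
  splitBlock-bounded {L} ((t , false) ∷ xs) l (t≤s ∷ _) with t ℕ.≟ suc L
  ... | yes refl = stripPlain-bounded false xs l
  ... | no t≢s = linked⇒bounded l (ℕP.≤-pred (ℕP.≤∧≢⇒< t≤s t≢s))
  splitBlock-bounded {L} ((t , true) ∷ xs) l (t≤s ∷ _) with t ℕ.≟ suc L
  ... | yes refl = stripPlain-bounded true xs l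
  ... | no t≢s = linked⇒bounded l (ℕP.≤-pred (ℕP.≤∧≢⇒< t≤s t≢s))

  linked-++⁻ʳ : ∀ xs {ys} → Linked _Follows_ (xs ++ ys) → Linked _Follows_ ys
  linked-++⁻ʳ [] l = l
  linked-++⁻ʳ (x ∷ xs) l = linked-++⁻ʳ xs (Linked.tail l)

  Valid-consBlock⁻ : ∀ s b j rest → Valid (consBlock s (b , j , rest)) → Valid rest
  Valid-consBlock⁻ s b j rest (pos , ord) =
    AllP.++⁻ʳ (plainParts s j) (AllP.++⁻ʳ (overlinedPart s b) pos) ,
    linked-++⁻ʳ (plainParts s j) (linked-++⁻ʳ (overlinedPart s b) ord)

  Valid-consBlock⁺ : ∀ {L} b j rest → Bounded L rest → Valid rest → Valid (consBlock (suc L) (b , j , rest))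
  Valid-consBlock⁺ {L} b j rest bnd (pos , ord) = positive⁺ b , ordered⁺ b
    where
    plain-positive : ∀ j → All (λ p → 1 ≤ proj₁ p) (plainParts (suc L) j ++ rest)
    plain-positive zero = pos
    plain-positive (suc j) = s≤s z≤n ∷ plain-positive j
    positive⁺ : ∀ b → All (λ p → 1 ≤ proj₁ p) (consBlock (suc L) (b , j , rest))
    positive⁺ true = s≤s z≤n ∷ plain-positive j
    positive⁺ false = plain-positive j
    head-follows : ∀ o j {ys} → Bounded L ys → Connected _Follows_ (Maybe.just (suc L , o)) (List.head (plainParts (suc L) j ++ ys))
    head-follows o (suc j) _ = just (inj₂ (refl , refl))
    head-follows o zero [] = just-nothing
    head-follows o zero (t≤L ∷ _) = just (inj₁ (s≤s t≤L))
    plain-ordered : ∀ j → Linked _Follows_ (plainParts (suc L) j ++ rest)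
    plain-ordered zero = ord
    plain-ordered (suc j) = head-follows false j bnd ∷′ plain-ordered j
    ordered⁺ : ∀ b → Linked _Follows_ (consBlock (suc L) (b , j , rest))
    ordered⁺ true = head-follows true j bnd ∷′ plain-ordered j
    ordered⁺ false = plain-ordered j

  hasOverlinedₗ-plainParts : ∀ t s j rest → hasOverlinedₗ t (plainParts s j ++ rest) ≡ hasOverlinedₗ t rest
  hasOverlinedₗ-plainParts t s zero rest = refl
  hasOverlinedₗ-plainParts t s (suc j) rest rewrite BoolP.∧-zeroʳ (s ≡ᵇ t) = hasOverlinedₗ-plainParts t s j rest

  nonOverCountₗ-plainParts : ∀ t s j rest →
    nonOverCountₗ t (plainParts s j ++ rest) ≡ (if s ≡ᵇ t then j else 0) + nonOverCountₗ t rest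
  nonOverCountₗ-plainParts t s zero rest with s ≡ᵇ t
  ... | true = refl
  ... | false = refl
  nonOverCountₗ-plainParts t s (suc j) rest rewrite nonOverCountₗ-plainParts t s j rest with s ≡ᵇ t
  ... | true = refl
  ... | false = refl

  hasOverlinedₗ-consBlock : ∀ t s b j rest →
    hasOverlinedₗ t (consBlock s (b , j , rest)) ≡ ((s ≡ᵇ t) ∧ b) ∨ hasOverlinedₗ t rest
  hasOverlinedₗ-consBlock t s true j rest = cong (((s ≡ᵇ t) ∧ true) ∨_) (hasOverlinedₗ-plainParts t s j rest)
  hasOverlinedₗ-consBlock t s false j rest rewrite BoolP.∧-zeroʳ (s ≡ᵇ t) = hasOverlinedₗ-plainParts t s j rest

  nonOverCountₗ-consBlock : ∀ t s b j rest →
    nonOverCountₗ t (consBlock s (b , j , rest)) ≡ (if s ≡ᵇ t then j else 0) + nonOverCountₗ t rest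
  nonOverCountₗ-consBlock t s true j rest rewrite BoolP.∧-zeroʳ (s ≡ᵇ t) = nonOverCountₗ-plainParts t s j rest
  nonOverCountₗ-consBlock t s false j rest = nonOverCountₗ-plainParts t s j rest

  hasOverlinedₗ-bounded : ∀ {L} xs → Bounded L xs → hasOverlinedₗ (suc L) xs ≡ false
  hasOverlinedₗ-bounded [] [] = refl
  hasOverlinedₗ-bounded {L} ((t , o) ∷ xs) (t≤L ∷ bnd)
    rewrite ≡ᵇ-≢ (ℕP.<⇒≢ (s≤s t≤L)) = hasOverlinedₗ-bounded xs bnd

  nonOverCountₗ-bounded : ∀ {L} xs → Bounded L xs → nonOverCountₗ (suc L) xs ≡ 0
  nonOverCountₗ-bounded [] [] = refl
  nonOverCountₗ-bounded {L} ((t , o) ∷ xs) (t≤L ∷ bnd)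
    rewrite ≡ᵇ-≢ (ℕP.<⇒≢ (s≤s t≤L)) = nonOverCountₗ-bounded xs bnd

  hasOverlinedₗ-consBlock-≢ : ∀ {t s} b j rest → s ≢ t → hasOverlinedₗ t (consBlock s (b , j , rest)) ≡ hasOverlinedₗ t rest
  hasOverlinedₗ-consBlock-≢ {t} {s} b j rest s≢t rewrite hasOverlinedₗ-consBlock t s b j rest | ≡ᵇ-≢ s≢t = refl

  nonOverCountₗ-consBlock-≢ : ∀ {t s} b j rest → s ≢ t → nonOverCountₗ t (consBlock s (b , j , rest)) ≡ nonOverCountₗ t rest
  nonOverCountₗ-consBlock-≢ {t} {s} b j rest s≢t rewrite nonOverCountₗ-consBlock t s b j rest | ≡ᵇ-≢ s≢t = refl

  hasOverlinedₗ-consBlock-self : ∀ {L} b j rest → Bounded L rest → hasOverlinedₗ (suc L) (consBlock (suc L) (b , j , rest)) ≡ b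
  hasOverlinedₗ-consBlock-self {L} b j rest bnd
    rewrite hasOverlinedₗ-consBlock (suc L) (suc L) b j rest | ≡ᵇ-refl L | hasOverlinedₗ-bounded rest bnd = BoolP.∨-identityʳ b

  nonOverCountₗ-consBlock-self : ∀ {L} b j rest → Bounded L rest → nonOverCountₗ (suc L) (consBlock (suc L) (b , j , rest)) ≡ j
  nonOverCountₗ-consBlock-self {L} b j rest bnd
    rewrite nonOverCountₗ-consBlock (suc L) (suc L) b j rest | ≡ᵇ-refl L | nonOverCountₗ-bounded rest bnd = ℕP.+-identityʳ j

  weightₗ-consBlock : ∀ s b j rest → weightₗ (consBlock s (b , j , rest)) ≡ weightₗ rest + blockWeight s b j
  weightₗ-consBlock s b j rest = begin
    weightₗ (overlinedPart s b ++ (plainParts s j ++ rest))        ≡⟨ weightₗ-++ (overlinedPart s b) _ ⟩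
    weightₗ (overlinedPart s b) + weightₗ (plainParts s j ++ rest) ≡⟨ cong₂ _+_ (overlined b) (weightₗ-++ (plainParts s j) rest) ⟩
    (if b then s else 0) + (weightₗ (plainParts s j) + weightₗ rest) ≡⟨ cong (λ w → (if b then s else 0) + (w + weightₗ rest)) (plain j) ⟩
    (if b then s else 0) + (s * j + weightₗ rest)                    ≡⟨ ℕP.+-assoc (if b then s else 0) (s * j) (weightₗ rest) ⟨
    blockWeight s b j + weightₗ rest                                 ≡⟨ ℕP.+-comm (blockWeight s b j) (weightₗ rest) ⟩
    weightₗ rest + blockWeight s b j                                 ∎
    where
    open ≡-Reasoning
    weightₗ-++ : ∀ xs ys → weightₗ (xs ++ ys) ≡ weightₗ xs + weightₗ ys
    weightₗ-++ [] ys = refl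
    weightₗ-++ (x ∷ xs) ys = trans (cong (proj₁ x +_) (weightₗ-++ xs ys)) (sym (ℕP.+-assoc (proj₁ x) _ _))
    overlined : ∀ b → weightₗ (overlinedPart s b) ≡ (if b then s else 0)
    overlined true = ℕP.+-identityʳ s
    overlined false = refl
    plain : ∀ j → weightₗ (plainParts s j) ≡ s * j
    plain zero = sym (ℕP.*-zeroʳ s)
    plain (suc j) = trans (cong (s +_) (plain j)) (sym (ℕP.*-suc s j))

  Bounded-consBlock : ∀ {L} b j rest → Bounded L rest → Bounded (suc L) (consBlock (suc L) (b , j , rest))
  Bounded-consBlock {L} b j rest bnd = overlined b
    where
    plain : ∀ j → Bounded (suc L) (plainParts (suc L) j ++ rest)
    plain zero = All.map ℕP.m≤n⇒m≤1+n bnd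
    plain (suc j) = ℕP.≤-refl ∷ plain j
    overlined : ∀ b → Bounded (suc L) (consBlock (suc L) (b , j , rest))
    overlined true = ℕP.≤-refl ∷ plain j
    overlined false = plain j

  nonOverCountₗ-≡0 : ∀ {s} xs → All (λ p → proj₁ p ≡ s → T (proj₂ p)) xs → nonOverCountₗ s xs ≡ 0
  nonOverCountₗ-≡0 [] [] = refl
  nonOverCountₗ-≡0 {s} ((t , o) ∷ xs) (over ∷ rest) with t ℕ.≟ s
  ... | no t≢s rewrite ≡ᵇ-≢ t≢s = nonOverCountₗ-≡0 xs rest
  ... | yes refl with o | over refl
  ...   | true | _ rewrite BoolP.∧-zeroʳ (t ≡ᵇ t) = nonOverCountₗ-≡0 xs rest

  ∈⇒1≤nonOverCountₗ : ∀ {t xs} → (t , false) ∈ xs → 1 ≤ nonOverCountₗ t xs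
  ∈⇒1≤nonOverCountₗ {t} (here refl) rewrite ≡ᵇ-refl t = s≤s z≤n
  ∈⇒1≤nonOverCountₗ {t} {(t′ , o) ∷ xs} (there t∈xs) with (t′ ≡ᵇ t) ∧ not o
  ... | true = ℕP.m≤n⇒m≤1+n (∈⇒1≤nonOverCountₗ t∈xs)
  ... | false = ∈⇒1≤nonOverCountₗ t∈xs

  nonOverCountₗ-≤-weightₗ : ∀ {s} xs → 1 ≤ s → nonOverCountₗ s xs ≤ weightₗ xs
  nonOverCountₗ-≤-weightₗ [] _ = z≤n
  nonOverCountₗ-≤-weightₗ {s} ((t , o) ∷ xs) 1≤s with t ℕ.≟ s
  ... | no t≢s rewrite ≡ᵇ-≢ t≢s = ℕP.≤-trans (nonOverCountₗ-≤-weightₗ xs 1≤s) (ℕP.m≤n+m (weightₗ xs) t)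
  ... | yes refl with o
  ...   | true rewrite BoolP.∧-zeroʳ (t ≡ᵇ t) = ℕP.≤-trans (nonOverCountₗ-≤-weightₗ xs 1≤s) (ℕP.m≤n+m (weightₗ xs) t)
  ...   | false rewrite ≡ᵇ-refl t = ℕP.+-mono-≤ 1≤s (nonOverCountₗ-≤-weightₗ xs 1≤s)

  bounded-by-weightₗ : ∀ xs → Bounded (weightₗ xs) xs
  bounded-by-weightₗ [] = []
  bounded-by-weightₗ ((t , o) ∷ xs) =
    ℕP.m≤m+n t (weightₗ xs) ∷ All.map (λ t′≤w → ℕP.≤-trans t′≤w (ℕP.m≤n+m (weightₗ xs) t)) (bounded-by-weightₗ xs)

  Occurs : ℕ → List Part → Set
  Occurs s = Any (λ p → proj₁ p ≡ s)

  absent-statistics : ∀ {s} xs → ¬ Occurs s xs → hasOverlinedₗ s xs ≡ false × nonOverCountₗ s xs ≡ 0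
  absent-statistics [] _ = refl , refl
  absent-statistics {s} ((t , o) ∷ xs) ¬occ rewrite ≡ᵇ-≢ (¬occ ∘ here) = absent-statistics xs (¬occ ∘ there)

  occurs-injective⇒≤ : ∀ {K} xs (f : Fin K → ℕ) → (∀ {i j} → f i ≡ f j → i ≡ j) → (∀ i → Occurs (f i) xs) → K ≤ length xs
  occurs-injective⇒≤ xs f f-injective occ = FinP.injective⇒≤ position-injective
    where
    position-injective : ∀ {i j} → Any.index (occ i) ≡ Any.index (occ j) → i ≡ j
    position-injective {i} {j} eq = f-injective (begin
      f i                                           ≡⟨ lookup-index (occ i) ⟨
      proj₁ (List.lookup xs (Any.index (occ i)))    ≡⟨ cong (proj₁ ∘ List.lookup xs) eq ⟩
      proj₁ (List.lookup xs (Any.index (occ j)))    ≡⟨ lookup-index (occ j) ⟩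
      f j                                           ∎)
      where open ≡-Reasoning

module LinearSearch where

  open import Data.Nat using (zero; suc; _+_; _≤_; _<_)
  import Data.Nat.Properties as ℕP
  open import Data.Bool using (true; false; T)
  open import Data.Unit using (tt)
  open import Data.Sum using (_⊎_; inj₁; inj₂)
  open import Relation.Nullary using (¬_; contradiction)
  open import Relation.Binary.PropositionalEquality

  searchFrom-minimal : ∀ P f st {i} → st ≤ i → i < searchFrom P f st → ¬ T (P i)
  searchFrom-minimal P zero st st≤i i<st = contradiction (ℕP.≤-<-trans st≤i i<st) (ℕP.<-irrefl refl)
  searchFrom-minimal P (suc f) st {i} st≤i i<res with P st in Pst≡
  ... | true = contradiction (ℕP.≤-<-trans st≤i i<res) (ℕP.<-irrefl refl)
  ... | false with ℕP.m≤n⇒m<n∨m≡n st≤i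
  ...   | inj₁ st<i = searchFrom-minimal P f (suc st) st<i i<res
  ...   | inj₂ refl = subst T Pst≡

  searchFrom-found⊎exhausted : ∀ P f st → T (P (searchFrom P f st)) ⊎ searchFrom P f st ≡ st + f
  searchFrom-found⊎exhausted P zero st = inj₂ (sym (ℕP.+-identityʳ st))
  searchFrom-found⊎exhausted P (suc f) st with P st in Pst≡
  ... | true = inj₁ (subst T (sym Pst≡) tt)
  ... | false with searchFrom-found⊎exhausted P f (suc st)
  ...   | inj₁ found = inj₁ found
  ...   | inj₂ eq = inj₂ (trans eq (sym (ℕP.+-suc st f)))

module Restricted (allow : ℕ → Bool → Bool) (R : ℕ → ℕ) where

  open PowerSeries
  open GeneratingFunctions
  open PartLists
  open import Data.Nat as ℕ using (zero; suc; _+_; _≤_; _<_; z≤n; s≤s)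
  import Data.Nat.Properties as ℕP
  open import Data.Bool using (true; false; T)
  open import Data.Bool.Properties using (T-irrelevant)
  open import Data.Unit using (⊤; tt)
  open import Data.Empty using (⊥-elim)
  open import Data.List using (List; []; _∷_)
  open import Data.List.Relation.Unary.All as All using ([]; _∷_)
  open import Data.List.Relation.Unary.Linked using ([])
  open import Data.Product using (Σ; _×_; _,_; proj₁; proj₂)
  open import Data.Sum using (inj₁; inj₂)
  open import Function using (_∘_; id)
  open import Function.Bundles using (_↔_; mk↔ₛ′; Inverse)
  open import Relation.Binary.PropositionalEquality

  SizeOK : ℕ → List Part → Set
  SizeOK s xs = T (allow s (hasOverlinedₗ s xs)) × nonOverCountₗ s xs < R s

  Fits : ℕ → List Part → Set
  Fits zero xs = ⊤
  Fits (suc L) xs = Fits L xs × SizeOK (suc L) xs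

  Fits-irrelevant : ∀ L {xs} (p q : Fits L xs) → p ≡ q
  Fits-irrelevant zero tt tt = refl
  Fits-irrelevant (suc L) (p , t , lt) (p′ , t′ , lt′) =
    cong₂ _,_ (Fits-irrelevant L p p′) (cong₂ _,_ (T-irrelevant t t′) (ℕP.≤-irrelevant lt lt′))

  Fits-intro : ∀ L {xs} → (∀ {s} → 1 ≤ s → s ≤ L → SizeOK s xs) → Fits L xs
  Fits-intro zero ok = tt
  Fits-intro (suc L) ok = Fits-intro L (λ 1≤s s≤L → ok 1≤s (ℕP.m≤n⇒m≤1+n s≤L)) , ok (s≤s z≤n) ℕP.≤-refl

  Fits-elim : ∀ L {xs} → Fits L xs → ∀ {s} → 1 ≤ s → s ≤ L → SizeOK s xs
  Fits-elim zero _ 1≤s s≤0 = ⊥-elim (ℕP.<-irrefl refl (ℕP.≤-trans 1≤s s≤0))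
  Fits-elim (suc L) (fits , ok) 1≤s s≤1+L with ℕP.m≤n⇒m<n∨m≡n s≤1+L
  ... | inj₁ s<1+L = Fits-elim L fits 1≤s (ℕP.≤-pred s<1+L)
  ... | inj₂ refl = ok

  Restricted : ℕ → Set
  Restricted L = Σ Overpartition λ π → Bounded L (parts π) × Fits L (parts π)

  restrictedWeight : ∀ {L} → Restricted L → ℕ
  restrictedWeight (π , _) = weight π

  Restricted-≡ : ∀ {L} {x y : Restricted L} → parts (proj₁ x) ≡ parts (proj₁ y) → x ≡ y
  Restricted-≡ {L} {π , bnd , fits} {π′ , bnd′ , fits′} eq with Overpartition-≡ {π} {π′} eq
  ... | refl = cong₂ (λ p q → π , p , q) (All.irrelevant ℕP.≤-irrelevant bnd bnd′) (Fits-irrelevant L fits fits′)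

  Block : ℕ → Set
  Block s = Σ Bool (T ∘ allow s) × Σ ℕ (_< R s)

  weightOfBlock : ∀ {s} → Block s → ℕ
  weightOfBlock {s} ((b , _) , (j , _)) = blockWeight s b j

  Block-≡ : ∀ {s} {x y : Block s} → proj₁ (proj₁ x) ≡ proj₁ (proj₁ y) → proj₁ (proj₂ x) ≡ proj₁ (proj₂ y) → x ≡ y
  Block-≡ {x = (b , t) , (j , lt)} {(.b , t′) , (.j , lt′)} refl refl =
    cong₂ (λ t lt → (b , t) , (j , lt)) (T-irrelevant t t′) (ℕP.≤-irrelevant lt lt′)

  SizeOK-consBlock-≢ : ∀ {s t} b j rest → s ≢ t → SizeOK t (consBlock s (b , j , rest)) ≡ SizeOK t rest
  SizeOK-consBlock-≢ {t = t} b j rest s≢t =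
    cong₂ (λ h c → T (allow t h) × c < R t) (hasOverlinedₗ-consBlock-≢ b j rest s≢t) (nonOverCountₗ-consBlock-≢ b j rest s≢t)

  Fits-consBlock : ∀ {L} b j rest → Bounded L rest →
    Fits (suc L) (consBlock (suc L) (b , j , rest)) ≡ (Fits L rest × T (allow (suc L) b) × j < R (suc L))
  Fits-consBlock {L} b j rest bnd = cong₂ _×_ (below L ℕP.≤-refl)
    (cong₂ (λ h c → T (allow (suc L) h) × c < R (suc L))
           (hasOverlinedₗ-consBlock-self b j rest bnd) (nonOverCountₗ-consBlock-self b j rest bnd))
    where
    below : ∀ L′ → L′ ≤ L → Fits L′ (consBlock (suc L) (b , j , rest)) ≡ Fits L′ rest
    below zero _ = refl
    below (suc L′) L′<L = cong₂ _×_ (below L′ (ℕP.<⇒≤ L′<L)) (SizeOK-consBlock-≢ b j rest (ℕP.>⇒≢ (s≤s L′<L)))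

  consBlock↔ : ∀ L → (Restricted L × Block (suc L)) ↔ Restricted (suc L)
  consBlock↔ L = mk↔ₛ′ to from to∘from from∘to
    where
    s = suc L
    to : Restricted L × Block s → Restricted s
    to ((π , bnd , fits) , (b , ok) , (j , j<R)) =
      toOverpartition (consBlock s (b , j , parts π)) (Valid-consBlock⁺ b j (parts π) bnd (valid π)) ,
      Bounded-consBlock b j (parts π) bnd ,
      subst id (sym (Fits-consBlock b j (parts π) bnd)) (fits , ok , j<R)
    from : Restricted s → Restricted L × Block s
    from (π , bnd , fits) =
      (toOverpartition rest (Valid-consBlock⁻ s b j rest (subst Valid (sym xs≡) (valid π))) , rest-bnd , proj₁ fits′) ,
      (b , proj₁ (proj₂ fits′)) , (j , proj₂ (proj₂ fits′))
      where
      xs = parts π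
      b = proj₁ (splitBlock s xs)
      j = proj₁ (proj₂ (splitBlock s xs))
      rest = proj₂ (proj₂ (splitBlock s xs))
      xs≡ : consBlock s (b , j , rest) ≡ xs
      xs≡ = consBlock-splitBlock s xs
      rest-bnd : Bounded L rest
      rest-bnd = splitBlock-bounded xs (ordered π) bnd
      fits′ : Fits L rest × T (allow s b) × j < R s
      fits′ = subst id (Fits-consBlock b j rest rest-bnd) (subst (Fits s) (sym xs≡) fits)
    to∘from : ∀ x → to (from x) ≡ x
    to∘from (π , _) = Restricted-≡ (consBlock-splitBlock s (parts π))
    from∘to : ∀ y → from (to y) ≡ y
    from∘to ((π , bnd , _) , (b , _) , (j , _)) = cong₂ _,_
      (Restricted-≡ (cong (proj₂ ∘ proj₂) split≡))
      (Block-≡ (cong proj₁ split≡) (cong (proj₁ ∘ proj₂) split≡))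
      where
      split≡ = splitBlock-consBlock b j (parts π) bnd

  weight-consBlock↔ : ∀ L (y : Restricted L × Block (suc L)) →
    restrictedWeight (Inverse.to (consBlock↔ L) y) ≡ restrictedWeight (proj₁ y) + weightOfBlock (proj₂ y)
  weight-consBlock↔ L ((π , _) , (b , _) , (j , _)) = weightₗ-consBlock (suc L) b j (parts π)

  blockGF : ℕ → PS
  blockGF s = (indicator (allow s false) 0 ⊕ indicator (allow s true) s) ⊗ geometric s (R s)

  HasGF-Block : ∀ s → HasGF (weightOfBlock {s}) (blockGF s)
  HasGF-Block s = HasGF-× (HasGF-overlined (allow s) s) (HasGF-plain s (R s))

  HasGF-Restricted : ∀ L → HasGF (restrictedWeight {L}) (prodF (blockGF ∘ suc) L)
  HasGF-Restricted zero = HasGF-↔ empty↔ (λ _ → refl) (HasGF-⊤ 0)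
    where
    empty↔ : ⊤ ↔ Restricted 0
    empty↔ = mk↔ₛ′ (λ _ → mkOP [] [] [] , [] , tt) (λ _ → tt) only (λ _ → refl)
      where
      only : ∀ x → (mkOP [] [] [] , [] , tt) ≡ x
      only (mkOP [] _ _ , _) = Restricted-≡ refl
      only (mkOP (_ ∷ _) (1≤t ∷ _) _ , t≤0 ∷ _ , _) = ⊥-elim (ℕP.<-irrefl refl (ℕP.≤-trans 1≤t t≤0))
  HasGF-Restricted (suc L) = HasGF-↔ (consBlock↔ L) (weight-consBlock↔ L) (HasGF-× (HasGF-Restricted L) (HasGF-Block (suc L)))

module Mes (A a r : ℕ) .{{_ : NonZero A}} (1≤a : 1 ≤ a) (a≤A : a ≤ A) (2≤r : 2 ≤ r) where

  open PartLists
  open LinearSearch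
  open PowerSeries using (sumℤ-select-none)
  open GeneratingFunctions using (Level; Level-≡)
  open import Data.Nat as ℕ using (zero; suc; _+_; _*_; _∸_; _<_; _%_; _/_; z≤n; s≤s; _≡ᵇ_; _<ᵇ_)
  import Data.Nat.Properties as ℕP
  import Data.Nat.DivMod as DivMod
  open import Data.Bool as Bool using (Bool; true; false; _∧_; _∨_; not; T; if_then_else_)
  open import Data.Bool.Properties using (T-∧; T-∨; T-not-≡; T-≡)
  open import Data.Integer using (0ℤ)
  open import Data.Unit using (tt)
  open import Data.Empty using (⊥-elim)
  open import Data.Fin using (Fin; toℕ)
  import Data.Fin.Properties as FinP
  open import Data.List as List using (List; []; _∷_; length)
  open import Data.List.Relation.Unary.All as All using (All; []; _∷_)
  import Data.List.Relation.Unary.Any as Any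
  open import Data.List.Membership.Propositional using (_∈_)
  open import Data.Product using (Σ; _×_; _,_; proj₁; proj₂)
  open import Data.Sum using (inj₁; inj₂)
  open import Function using (_∘_; id)
  open import Function.Bundles using (_↔_; mk↔ₛ′; Equivalence)
  open import Relation.Nullary using (¬_; yes; no; contradiction; Dec)
  open import Relation.Nullary.Decidable using (T?)
  open import Relation.Binary.Definitions using (tri<; tri≈; tri>)
  open import Relation.Binary.PropositionalEquality
  open import Axiom.UniquenessOfIdentityProofs using (module Decidable⇒UIP)

  open Equivalence using () renaming (to to ⇔-to; from to ⇔-from)

  progression-% : ∀ j → (j * A + a) % A ≡ a % A
  progression-% j = trans (cong (_% A) (ℕP.+-comm (j * A) a)) (DivMod.[m+kn]%n≡m%n a j A)

  progression-injective : ∀ {j j′} → j * A + a ≡ j′ * A + a → j ≡ j′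
  progression-injective {j} {j′} eq = ℕP.*-cancelʳ-≡ j j′ A (ℕP.+-cancelʳ-≡ a (j * A) (j′ * A) eq)

  progression-<⁻ : ∀ {j j′} → j * A + a < j′ * A + a → j < j′
  progression-<⁻ {j} {j′} lt = ℕP.*-cancelʳ-< A j j′ (ℕP.+-cancelʳ-< a (j * A) (j′ * A) lt)

  progression-< : ∀ {j j′} → j < j′ → j * A + a < j′ * A + a
  progression-< lt = ℕP.+-monoˡ-< a (ℕP.*-monoˡ-< A lt)

  1≤progression : ∀ j → 1 ≤ j * A + a
  1≤progression j = ℕP.≤-trans 1≤a (ℕP.m≤n+m a (j * A))

  -- Needs a ≤ A: otherwise a - A would be a smaller positive solution.
  progression-%⁻ : ∀ {s} → 1 ≤ s → s % A ≡ a % A → Σ ℕ λ j → j * A + a ≡ s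
  progression-%⁻ {s} 1≤s s%A≡a%A with ℕP.m≤n⇒m<n∨m≡n a≤A
  ... | inj₁ a<A = s / A , sym (begin
    s                    ≡⟨ DivMod.m≡m%n+[m/n]*n s A ⟩
    s % A + s / A * A    ≡⟨ cong (_+ s / A * A) (trans s%A≡a%A (DivMod.m<n⇒m%n≡m a<A)) ⟩
    a + s / A * A        ≡⟨ ℕP.+-comm a (s / A * A) ⟩
    s / A * A + a        ∎)
    where open ≡-Reasoning
  ... | inj₂ refl = predecessor (s / a) (DivMod.m≡m%n+[m/n]*n s a)
    where
    s%a≡0 : s % a ≡ 0
    s%a≡0 = trans s%A≡a%A (DivMod.n%n≡0 a)
    predecessor : ∀ q → s ≡ s % a + q * a → Σ ℕ λ j → j * a + a ≡ s
    predecessor zero s≡ = ⊥-elim (ℕP.<⇒≢ 1≤s (sym (trans s≡ (cong (_+ 0) s%a≡0))))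
    predecessor (suc j) s≡ = j , sym (trans s≡ (trans (cong (_+ suc j * a) s%a≡0) (ℕP.+-comm a (j * a))))

  isSpecial : ℕ → ℕ → Bool
  isSpecial zero s = false
  isSpecial (suc K) s = isSpecial K s ∨ (K * A + a ≡ᵇ s)

  isSpecial-elim : ∀ K {s} → T (isSpecial K s) → Σ ℕ λ j → j < K × j * A + a ≡ s
  isSpecial-elim (suc K) {s} sp with ⇔-to T-∨ sp
  ... | inj₁ sp′ = let j , j<K , eq = isSpecial-elim K sp′ in j , ℕP.m<n⇒m<1+n j<K , eq
  ... | inj₂ eq = K , ℕP.≤-refl , ℕP.≡ᵇ⇒≡ _ s eq

  isSpecial-intro : ∀ K {j} → j < K → T (isSpecial K (j * A + a))
  isSpecial-intro (suc K) {j} j<1+K with ℕP.m≤n⇒m<n∨m≡n (ℕP.≤-pred j<1+K)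
  ... | inj₁ j<K = ⇔-from T-∨ (inj₁ (isSpecial-intro K j<K))
  ... | inj₂ refl = ⇔-from T-∨ (inj₂ (ℕP.≡⇒≡ᵇ (j * A + a) _ refl))

  ¬isSpecial-self : ∀ K → ¬ T (isSpecial K (K * A + a))
  ¬isSpecial-self K sp = let j , j<K , eq = isSpecial-elim K sp in ℕP.<⇒≢ j<K (progression-injective eq)

  Candidate : Overpartition → ℕ → Set
  Candidate π s = 1 ≤ s × s % A ≡ a % A × hasOverlined s π ≡ false × nonOverCount s π < r ∸ 1

  candidate-intro : ∀ π {s} → Candidate π s → T (mesCandidate r A a π s)
  candidate-intro π {s} (1≤s , s%A , ¬over , count<) = ⇔-from T-∧ (ℕP.<⇒<ᵇ 1≤s ,
    ⇔-from T-∧ (ℕP.≡⇒≡ᵇ (s % A) (a % A) s%A , ⇔-from T-∧ (⇔-from T-not-≡ ¬over , ℕP.<⇒<ᵇ count<)))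

  candidate-elim : ∀ π {s} → T (mesCandidate r A a π s) → Candidate π s
  candidate-elim π {s} cand =
    let 0<s , rest₁ = ⇔-to T-∧ cand ; s%A , rest₂ = ⇔-to T-∧ rest₁ ; ¬over , count< = ⇔-to T-∧ rest₂ in
    ℕP.<ᵇ⇒< 0 s 0<s , ℕP.≡ᵇ⇒≡ (s % A) (a % A) s%A , ⇔-to T-not-≡ ¬over , ℕP.<ᵇ⇒< _ (r ∸ 1) count<

  1≤r∸1 : 1 ≤ r ∸ 1
  1≤r∸1 = ℕP.∸-monoˡ-≤ 1 2≤r

  non-candidate⇒occurs : ∀ π {s} → 1 ≤ s → s % A ≡ a % A → ¬ T (mesCandidate r A a π s) → Occurs s (parts π)
  non-candidate⇒occurs π {s} 1≤s s%A ¬cand with Any.any? (λ p → proj₁ p ℕ.≟ s) (parts π)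
  ... | yes occ = occ
  ... | no ¬occ = let ¬over , count≡0 = absent-statistics (parts π) ¬occ in
    contradiction (candidate-intro π (1≤s , s%A , ¬over , subst (_< r ∸ 1) (sym count≡0) 1≤r∸1)) ¬cand

  mes-minimal : ∀ π {i} → 1 ≤ i → i < mes r A a π → ¬ T (mesCandidate r A a π i)
  mes-minimal π 1≤i = searchFrom-minimal (mesCandidate r A a π) (a + A * suc (length (parts π))) 1 1≤i

  -- The search cannot run out of fuel: a + A·j for j ≤ #parts would all have to occur in π.
  mes-isCandidate : ∀ π → T (mesCandidate r A a π (mes r A a π))
  mes-isCandidate π with searchFrom-found⊎exhausted (mesCandidate r A a π) (a + A * suc (length (parts π))) 1
  ... | inj₁ found = found
  ... | inj₂ exhausted = contradiction
    (occurs-injective⇒≤ (parts π) (λ i → toℕ i * A + a) (FinP.toℕ-injective ∘ progression-injective) occurs)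
    (ℕP.<-irrefl refl)
    where
    p = length (parts π)
    below-mes : ∀ (i : Fin (suc p)) → toℕ i * A + a < mes r A a π
    below-mes i = subst (toℕ i * A + a <_) (sym exhausted) (s≤s (begin
      toℕ i * A + a    ≤⟨ ℕP.+-monoˡ-≤ a (ℕP.*-monoˡ-≤ A (ℕP.≤-pred (FinP.toℕ<n i))) ⟩
      p * A + a        ≤⟨ ℕP.+-monoˡ-≤ a (ℕP.*-monoˡ-≤ A (ℕP.n≤1+n p)) ⟩
      suc p * A + a    ≡⟨ ℕP.+-comm (suc p * A) a ⟩
      a + suc p * A    ≡⟨ cong (a +_) (ℕP.*-comm (suc p) A) ⟩
      a + A * suc p    ∎))
      where open ℕP.≤-Reasoning
    occurs : ∀ i → Occurs (toℕ i * A + a) (parts π)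
    occurs i = non-candidate⇒occurs π (1≤progression (toℕ i)) (progression-% (toℕ i))
      (mes-minimal π (1≤progression (toℕ i)) (below-mes i))

  mes-≡ : ∀ π {x} → T (mesCandidate r A a π x) → (∀ {i} → 1 ≤ i → i < x → ¬ T (mesCandidate r A a π i)) → mes r A a π ≡ x
  mes-≡ π {x} cand below with ℕP.<-cmp (mes r A a π) x
  ... | tri≈ _ eq _ = eq
  ... | tri< mes<x _ _ = contradiction (mes-isCandidate π) (below (proj₁ (candidate-elim π (mes-isCandidate π))) mes<x)
  ... | tri> _ _ x<mes = contradiction cand (mes-minimal π (proj₁ (candidate-elim π cand)) x<mes)

  mes-progression : ∀ π → Σ ℕ λ j → j * A + a ≡ mes r A a π
  mes-progression π = let 1≤mes , mes%A , _ = candidate-elim π (mes-isCandidate π) in progression-%⁻ 1≤mes mes%A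

  inO : ℕ → List Part → Bool
  inO M = List.foldr (λ p acc → (not (((proj₁ p % A) ≡ᵇ (a % A)) ∧ (proj₁ p <ᵇ M)) ∨ proj₂ p) ∧ acc) true

  OverlinedBelow : ℕ → Part → Set
  OverlinedBelow M (t , o) = t % A ≡ a % A → t < M → T o

  inO-elim : ∀ M xs → T (inO M xs) → All (OverlinedBelow M) xs
  inO-elim M [] _ = []
  inO-elim M ((t , o) ∷ xs) inO-t =
    let head , rest = ⇔-to T-∧ inO-t in
    (λ t%A t<M → ⇔-to (not-∨⇔→ _ o) head (⇔-from T-∧ (ℕP.≡⇒≡ᵇ (t % A) (a % A) t%A , ℕP.<⇒<ᵇ t<M))) ∷ inO-elim M xs rest

  inO-intro : ∀ M xs → All (OverlinedBelow M) xs → T (inO M xs)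
  inO-intro M [] [] = tt
  inO-intro M ((t , o) ∷ xs) (over ∷ rest) = ⇔-from T-∧
    (⇔-from (not-∨⇔→ _ o) (λ c → let t%A , t<M = ⇔-to T-∧ c in over (ℕP.≡ᵇ⇒≡ (t % A) (a % A) t%A) (ℕP.<ᵇ⇒< t M t<M)) ,
     inO-intro M xs rest)

  data SizeClass : Set where
    special critical free : SizeClass

  allowed : SizeClass → Bool → Bool
  allowed special b = b
  allowed critical b = not b
  allowed free _ = true

  -- The special sizes are a, a + A, …, m - A and the critical size is m. The bound suc n for the free sizes is
  -- no restriction, as at most n parts of size s ≥ 1 fit in weight n.
  module Characterisation (k n : ℕ) where

    m L : ℕ
    m = k * A + a
    L = n + m

    classify : ℕ → SizeClass
    classify s = if isSpecial k s then special else if s ≡ᵇ m then critical else free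

    maxCount : SizeClass → ℕ
    maxCount special = 1
    maxCount critical = r ∸ 1
    maxCount free = suc n

    open Restricted (allowed ∘ classify) (maxCount ∘ classify) public

    SizeOK-classify : ∀ {s xs c} → classify s ≡ c →
      SizeOK s xs ≡ (T (allowed c (hasOverlinedₗ s xs)) × nonOverCountₗ s xs < maxCount c)
    SizeOK-classify refl = refl

    classify-special : ∀ {s} → T (isSpecial k s) → classify s ≡ special
    classify-special {s} sp rewrite Equivalence.to T-≡ sp = refl

    classify-critical : classify m ≡ critical
    classify-critical with isSpecial k m in sp≡
    ... | true = contradiction (subst T (sym sp≡) tt) (¬isSpecial-self k)
    ... | false rewrite ≡ᵇ-refl m = refl

    classify-free : ∀ {s} → ¬ T (isSpecial k s) → s ≢ m → classify s ≡ free
    classify-free {s} ¬sp s≢m with isSpecial k s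
    ... | true = contradiction tt ¬sp
    ... | false rewrite ≡ᵇ-≢ s≢m = refl

    special⇒ : ∀ {s} → T (isSpecial k s) → 1 ≤ s × s < m × s % A ≡ a % A
    special⇒ sp with isSpecial-elim k sp
    ... | j , j<k , refl = 1≤progression j , progression-< j<k , progression-% j

    ⇒special : ∀ {s} → 1 ≤ s → s < m → s % A ≡ a % A → T (isSpecial k s)
    ⇒special 1≤s s<m s%A with progression-%⁻ 1≤s s%A
    ... | j , refl = isSpecial-intro k (progression-<⁻ {j} {k} s<m)

    bounded : ∀ π → weight π ≡ n → Bounded L (parts π)
    bounded π w≡n = All.map (λ t≤w → ℕP.≤-trans t≤w (subst (_≤ L) (sym w≡n) (ℕP.m≤m+n n m))) (bounded-by-weightₗ (parts π))

    OMes⇒Fits : ∀ π → weight π ≡ n → T (inOMes r A a π) → mes r A a π ≡ m → Fits L (parts π)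
    OMes⇒Fits π w≡n inOMes-π mes≡m = Fits-intro L sizeOK
      where
      xs = parts π
      sizeOK : ∀ {s} → 1 ≤ s → s ≤ L → SizeOK s xs
      sizeOK {s} 1≤s s≤L with T? (isSpecial k s) | s ℕ.≟ m
      ... | yes sp | _ = subst id (sym (SizeOK-classify {xs = xs} (classify-special sp))) (over , subst (_< 1) (sym count≡0) (s≤s z≤n))
        where
        s<m = proj₁ (proj₂ (special⇒ sp))
        s%A = proj₂ (proj₂ (special⇒ sp))
        count≡0 : nonOverCountₗ s xs ≡ 0
        count≡0 = nonOverCountₗ-≡0 xs (All.map (λ {(t , o)} below t≡s → below (subst (λ t → t % A ≡ a % A) (sym t≡s) s%A)
                    (subst₂ _<_ (sym t≡s) (sym mes≡m) s<m)) (inO-elim (mes r A a π) xs inOMes-π))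
        over : T (hasOverlinedₗ s xs)
        over with hasOverlinedₗ s xs in over≡
        ... | true = tt
        ... | false = contradiction (candidate-intro π (1≤s , s%A , over≡ , subst (_< r ∸ 1) (sym count≡0) 1≤r∸1))
                        (mes-minimal π 1≤s (subst (s <_) (sym mes≡m) s<m))
      ... | no _ | yes refl = subst id (sym (SizeOK-classify {xs = xs} classify-critical)) (⇔-from T-not-≡ ¬over , count<)
        where
        m-candidate = candidate-elim π (subst (T ∘ mesCandidate r A a π) mes≡m (mes-isCandidate π))
        ¬over = proj₁ (proj₂ (proj₂ m-candidate))
        count< = proj₂ (proj₂ (proj₂ m-candidate))
      ... | no ¬sp | no s≢m = subst id (sym (SizeOK-classify {xs = xs} (classify-free ¬sp s≢m)))
        (tt , s≤s (subst (nonOverCountₗ s xs ≤_) w≡n (nonOverCountₗ-≤-weightₗ xs 1≤s)))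

    Fits⇒OMes : ∀ π → Fits L (parts π) → T (inOMes r A a π) × mes r A a π ≡ m
    Fits⇒OMes π fits = subst (λ M → T (inO M xs)) (sym mes≡m) (inO-intro m xs (All.tabulate overlined-below)) , mes≡m
      where
      xs = parts π
      special-sizes : ∀ {s} → T (isSpecial k s) → T (hasOverlinedₗ s xs) × nonOverCountₗ s xs ≡ 0
      special-sizes sp with special⇒ sp
      ... | 1≤s , s<m , _ with subst id (SizeOK-classify {xs = xs} (classify-special sp))
                                   (Fits-elim L fits 1≤s (ℕP.≤-trans (ℕP.<⇒≤ s<m) (ℕP.m≤n+m m n)))
      ...   | over , count<1 = over , ℕP.n<1⇒n≡0 count<1
      critical-size : T (not (hasOverlinedₗ m xs)) × nonOverCountₗ m xs < r ∸ 1
      critical-size = subst id (SizeOK-classify {xs = xs} classify-critical) (Fits-elim L fits (1≤progression k) (ℕP.m≤n+m m n))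
      below-m : ∀ {i} → 1 ≤ i → i < m → ¬ T (mesCandidate r A a π i)
      below-m 1≤i i<m cand with candidate-elim π cand
      ... | _ , i%A , ¬over , _ = subst T ¬over (proj₁ (special-sizes (⇒special 1≤i i<m i%A)))
      mes≡m : mes r A a π ≡ m
      mes≡m = mes-≡ π (candidate-intro π (1≤progression k , progression-% k , ⇔-to T-not-≡ (proj₁ critical-size) , proj₂ critical-size)) below-m
      overlined-below : ∀ {p} → p ∈ xs → OverlinedBelow m p
      overlined-below {t , true} _ _ _ = tt
      overlined-below {t , false} t∈xs t%A t<m
        with subst (1 ≤_) (proj₂ (special-sizes (⇒special (All.lookup (positive π) t∈xs) t<m t%A))) (∈⇒1≤nonOverCountₗ t∈xs)
      ... | ()

    OMesSet↔Level : OMesSet r A a m n ↔ Level (restrictedWeight {L}) n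
    OMesSet↔Level = mk↔ₛ′
      (λ (π , inOMes-π , mes≡m , w≡n) →
         (π , bounded π w≡n , OMes⇒Fits π w≡n (⇔-from T-≡ inOMes-π) mes≡m) , w≡n)
      (λ ((π , _ , fits) , w≡n) → π , ⇔-to T-≡ (proj₁ (Fits⇒OMes π fits)) , proj₂ (Fits⇒OMes π fits) , w≡n)
      (λ _ → Level-≡ (Restricted-≡ refl))
      (λ (π , _ , _ , w≡n) → cong₂ (λ p q → π , p , q , w≡n) (Bool-UIP _ _) (ℕP.≡-irrelevant _ _))
      where open Decidable⇒UIP Bool._≟_ renaming (≡-irrelevant to Bool-UIP)

  OMesSet-empty : ∀ {m′ n} → (∀ j → j * A + a ≢ m′) → ¬ OMesSet r A a m′ n
  OMesSet-empty not-progression (π , _ , mes≡m′ , _) = let j , eq = mes-progression π in not-progression j (trans eq mes≡m′)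

  rhsCoeff-≡0 : ∀ {m′} n → (∀ j → j * A + a ≢ m′) → rhsCoeff r A a m′ n ≡ 0ℤ
  rhsCoeff-≡0 {m′} n not-progression = sumℤ-select-none (suc m′) (λ j → rhsTerm r A a j n) (λ j → ≡ᵇ-≢ (not-progression j))

  progression? : ∀ m → Dec (Σ ℕ λ k → k * A + a ≡ m)
  progression? m with 1 ℕ.≤? m | m % A ℕ.≟ a % A
  ... | yes 1≤m | yes m%A = yes (progression-%⁻ 1≤m m%A)
  ... | no 1≰m | _ = no (λ (k , eq) → 1≰m (subst (1 ≤_) eq (1≤progression k)))
  ... | _ | no m%A≢ = no (λ (k , eq) → m%A≢ (subst (λ x → x % A ≡ a % A) eq (progression-% k)))

module SeriesIdentity (A a r : ℕ) .{{_ : NonZero A}} (1≤a : 1 ≤ a) (a≤A : a ≤ A) (2≤r : 2 ≤ r) (k n : ℕ) where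

  open PowerSeries
  open GeneratingFunctions using (indicator)
  open PartLists using (≡ᵇ-refl; ≡ᵇ-≢; ¬T⇒≡false)
  open Mes A a r 1≤a a≤A 2≤r
  open Characterisation k n public
  open import Data.Nat as ℕ using (zero; suc; _+_; _*_; _∸_; _<_; z≤n; s≤s; _≡ᵇ_)
  import Data.Nat.Properties as ℕP
  open import Data.Nat.Combinatorics using (_C_; nC1≡n; nCk+nC[k+1]≡[n+1]C[k+1])
  open import Data.Integer as ℤ using (1ℤ; -_)
  import Data.Integer.Properties as ℤP
  open import Data.Bool using (true; false; if_then_else_)
  open import Data.Bool.Properties using (T-≡; ∨-identityʳ)
  open import Data.Product using (proj₁; proj₂)
  open import Function using (_∘_)
  open import Function.Bundles using (Equivalence)
  open import Relation.Nullary using (yes; no)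
  open import Relation.Nullary.Decidable using (T?)
  open import Relation.Binary.PropositionalEquality
  import Relation.Binary.Reasoning.Setoid as SetoidReasoning

  classBlockGF : SizeClass → ℕ → PS
  classBlockGF c s = (indicator (allowed c false) 0 ⊕ indicator (allowed c true) s) ⊗ geometric s (maxCount c)

  -- The factor that the size s contributes to the denominator (q; q)_L (-q^a; q^A)_{k+1} and the numerator
  -- (-q; q)_L q^{A C(k,2) + k a} (q^a; q^A)_k (1 - q^{m (r-1)}) of the generating function.
  denominator numerator : SizeClass → ℕ → PS
  denominator special s = P⁺ s
  denominator critical s = P⁺ s
  denominator free s = one
  numerator special s = mono 1ℤ s ⊗ P⁻ s
  numerator critical s = one ⊖ mono 1ℤ (s * (r ∸ 1))
  numerator free s = one

  classBlockGF-identity : ∀ c {s} → 1 ≤ s →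
    classBlockGF c s ⊗ P⁻ s ⊗ denominator c s ≈[ n ] P⁺ s ⊗ numerator c s
  classBlockGF-identity special {s} _ = ≈⇒≈[] n (λ i → trans
    (⊗-cong {g = P⁺ s} (⊗-cong {g = P⁻ s} (⊗-cong {g = geometric s 1} overlined plain) (λ _ → refl)) (λ _ → refl) i)
    (⊗-Solver.solve 3 (λ x y z → ((x ⊕′ ε) ⊕′ y) ⊕′ z ⊜ z ⊕′ (x ⊕′ y)) (λ _ → refl) (mono 1ℤ s) (P⁻ s) (P⁺ s) i))
    where
    open ⊗-Solver using (_⊜_) renaming (_⊕_ to _⊕′_; id to ε)
    overlined : zeroPS ⊕ mono 1ℤ s ≈ mono 1ℤ s
    overlined i = ℤP.+-identityˡ (mono 1ℤ s i)
    plain : geometric s 1 ≈ one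
    plain i = trans (ℤP.+-identityˡ (mono 1ℤ (s * 0) i)) (cong (λ e → mono 1ℤ e i) (ℕP.*-zeroʳ s))
  classBlockGF-identity critical {s} _ = ≈⇒≈[] n (λ i → trans
    (⊗-cong {g = P⁺ s} (⊗-cong {g = P⁻ s} (⊗-cong {g = geometric s (r ∸ 1)} overlined (λ _ → refl)) (λ _ → refl)) (λ _ → refl) i)
    (trans (⊗-Solver.solve 3 (λ x y z → ((ε ⊕′ x) ⊕′ y) ⊕′ z ⊜ z ⊕′ (x ⊕′ y)) (λ _ → refl) (geometric s (r ∸ 1)) (P⁻ s) (P⁺ s) i)
           (⊗-cong {P⁺ s} (λ _ → refl) (geometric-⊗-P⁻ s (r ∸ 1)) i)))
    where
    open ⊗-Solver using (_⊜_) renaming (_⊕_ to _⊕′_; id to ε)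
    overlined : one ⊕ zeroPS ≈ one
    overlined i = ℤP.+-identityʳ (one i)
  classBlockGF-identity free {s} 1≤s = begin
    classBlockGF free s ⊗ P⁻ s ⊗ one                ≈⟨ ≈⇒≈[] n (λ i → trans
      (⊗-cong {g = one} (⊗-cong {g = P⁻ s} (⊗-cong {g = geometric s (suc n)} (P⁺≈one⊕mono s) (λ _ → refl)) (λ _ → refl)) (λ _ → refl) i)
      (⊗-Solver.solve 3 (λ x y z → ((x ⊕′ y) ⊕′ z) ⊕′ ε ⊜ x ⊕′ (y ⊕′ z)) (λ _ → refl) (P⁺ s) (geometric s (suc n)) (P⁻ s) i)) ⟩
    P⁺ s ⊗ (geometric s (suc n) ⊗ P⁻ s)             ≈⟨ ≈⇒≈[] n (⊗-cong {P⁺ s} (λ _ → refl) (geometric-⊗-P⁻ s (suc n))) ⟩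
    P⁺ s ⊗ (one ⊖ mono 1ℤ (s * suc n))              ≈⟨ ⊗-cong[] {P⁺ s} (λ _ _ → refl) (one-⊖-≈[]-one 1ℤ n<s[1+n]) ⟩
    P⁺ s ⊗ one                                      ∎
    where
    open SetoidReasoning (≈[]-setoid n)
    open ⊗-Solver using (_⊜_) renaming (_⊕_ to _⊕′_; id to ε)
    n<s[1+n] : n < s * suc n
    n<s[1+n] = ℕP.≤-trans (ℕP.≤-reflexive (sym (ℕP.*-identityˡ (suc n)))) (ℕP.*-monoˡ-≤ (suc n) 1≤s)

  m≤L : m ≤ L
  m≤L = ℕP.m≤n+m m n

  prodF-isSpecial : ∀ (X : ℕ → PS) K → K ≤ suc k → prodF (λ i → if isSpecial K (suc i) then X (suc i) else one) L ≈ prodF (λ j → X (j * A + a)) K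
  prodF-isSpecial X zero _ = prodF-one L
  prodF-isSpecial X (suc K) K<1+k i = trans
    (prodF-factorAtSize {λ i → if isSpecial (suc K) (suc i) then X (suc i) else one} {λ i → if isSpecial K (suc i) then X (suc i) else one}
       (X (K * A + a)) L (1≤progression K) KA+a≤L others new i)
    (⊗-cong {g = X (K * A + a)} (prodF-isSpecial X K (ℕP.<⇒≤ K<1+k)) (λ _ → refl) i)
    where
    KA+a≤L : K * A + a ≤ L
    KA+a≤L = ℕP.≤-trans (ℕP.+-monoˡ-≤ a (ℕP.*-monoˡ-≤ A (ℕP.≤-pred K<1+k))) m≤L
    others : ∀ i → suc i ≢ K * A + a → (if isSpecial (suc K) (suc i) then X (suc i) else one) ≈ (if isSpecial K (suc i) then X (suc i) else one)
    others i ne rewrite ≡ᵇ-≢ (ne ∘ sym) | ∨-identityʳ (isSpecial K (suc i)) = λ _ → refl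
    new : ∀ i → suc i ≡ K * A + a → (if isSpecial (suc K) (suc i) then X (suc i) else one) ≈ (if isSpecial K (suc i) then X (suc i) else one) ⊗ X (K * A + a)
    new i eq rewrite eq | ¬T⇒≡false (¬isSpecial-self K) | ≡ᵇ-refl (K * A + a) = λ j → sym (⊗-identityˡ (X (K * A + a)) j)

  prodF-at-m : ∀ (Y : PS) → prodF (λ i → if suc i ≡ᵇ m then Y else one) L ≈ Y
  prodF-at-m Y i = trans (prodF-factorAtSize {λ i → if suc i ≡ᵇ m then Y else one} {λ _ → one} Y L (1≤progression k) m≤L others new i)
    (trans (⊗-cong {g = Y} (prodF-one L) (λ _ → refl) i) (⊗-identityˡ Y i))
    where
    others : ∀ i → suc i ≢ m → (if suc i ≡ᵇ m then Y else one) ≈ one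
    others i ne rewrite ≡ᵇ-≢ ne = λ _ → refl
    new : ∀ i → suc i ≡ m → (if suc i ≡ᵇ m then Y else one) ≈ one ⊗ Y
    new i eq rewrite eq | ≡ᵇ-refl m = λ j → sym (⊗-identityˡ Y j)

  critical-factor : PS
  critical-factor = one ⊖ mono 1ℤ (m * (r ∸ 1))

  denominator-classify : ∀ s → denominator (classify s) s ≈ (if isSpecial (suc k) s then P⁺ s else one)
  denominator-classify s with T? (isSpecial k s) | s ℕ.≟ m
  ... | yes sp | _ rewrite classify-special sp | Equivalence.to T-≡ sp = λ _ → refl
  ... | no ¬sp | yes refl rewrite classify-critical | ¬T⇒≡false ¬sp | ≡ᵇ-refl m = λ _ → refl
  ... | no ¬sp | no s≢m rewrite classify-free ¬sp s≢m | ¬T⇒≡false ¬sp | ≡ᵇ-≢ (s≢m ∘ sym) = λ _ → refl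

  numerator-classify : ∀ s → numerator (classify s) s ≈ (if isSpecial k s then mono 1ℤ s ⊗ P⁻ s else one) ⊗ (if s ≡ᵇ m then critical-factor else one)
  numerator-classify s with T? (isSpecial k s) | s ℕ.≟ m
  ... | yes sp | _ rewrite classify-special sp | Equivalence.to T-≡ sp | ≡ᵇ-≢ (ℕP.<⇒≢ (proj₁ (proj₂ (special⇒ sp)))) =
    λ i → sym (⊗-identityʳ (mono 1ℤ s ⊗ P⁻ s) i)
  ... | no ¬sp | yes refl rewrite classify-critical | ¬T⇒≡false ¬sp | ≡ᵇ-refl m = λ i → sym (⊗-identityˡ critical-factor i)
  ... | no ¬sp | no s≢m rewrite classify-free ¬sp s≢m | ¬T⇒≡false ¬sp | ≡ᵇ-≢ s≢m = λ i → sym (⊗-identityˡ one i)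

  e₁ : ℕ
  e₁ = A * (k C 2) + k * a

  progression-powers : ∀ K → prodF (λ j → mono 1ℤ (j * A + a)) K ≈ mono 1ℤ (A * (K C 2) + K * a)
  progression-powers zero i = cong (λ e → mono 1ℤ (e + 0) i) (sym (ℕP.*-zeroʳ A))
  progression-powers (suc K) i = trans (⊗-cong {g = mono 1ℤ (K * A + a)} (progression-powers K) (λ _ → refl) i)
    (trans (mono-mono (A * (K C 2) + K * a) (K * A + a) i) (cong (λ e → mono 1ℤ e i) exponent≡))
    where
    open import Data.Nat.Solver using (module +-*-Solver)
    open +-*-Solver using (solve; _:+_; _:*_; _:=_)
    exponent≡ : A * (K C 2) + K * a + (K * A + a) ≡ A * (suc K C 2) + suc K * a
    exponent≡ = trans (regroup A a K (K C 2)) (cong (λ c → A * c + suc K * a)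
      (trans (cong (_+ K C 2) (sym (nC1≡n K))) (nCk+nC[k+1]≡[n+1]C[k+1] K 1)))
      where
      regroup : ∀ A a K x → A * x + K * a + (K * A + a) ≡ A * (K + x) + (a + K * a)
      regroup = solve 4 (λ A a K x → A :* x :+ K :* a :+ (K :* A :+ a) := A :* (K :+ x) :+ (a :+ K :* a)) refl

  ∏P⁻ ∏P⁺ ∏P⁺-progression ∏P⁻-special : PS
  ∏P⁻ = poch 1ℤ 1 1 L
  ∏P⁺ = poch (- 1ℤ) 1 1 L
  ∏P⁺-progression = poch (- 1ℤ) a A (suc k)
  ∏P⁻-special = poch 1ℤ a A k

  prodF-P⁻ : prodF (P⁻ ∘ suc) L ≈ ∏P⁻
  prodF-P⁻ = prodF-cong L (λ i _ j → cong (λ e → (one ⊖ mono 1ℤ e) j) (cong suc (sym (ℕP.*-identityˡ i))))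

  prodF-P⁺ : prodF (P⁺ ∘ suc) L ≈ ∏P⁺
  prodF-P⁺ = prodF-cong L (λ i _ j → cong (λ e → (one ⊖ mono (- 1ℤ) e) j) (cong suc (sym (ℕP.*-identityˡ i))))

  progression≡ : ∀ j → j * A + a ≡ a + A * j
  progression≡ j = trans (ℕP.+-comm (j * A) a) (cong (a +_) (ℕP.*-comm j A))

  prodF-denominator : prodF (λ i → denominator (classify (suc i)) (suc i)) L ≈ ∏P⁺-progression
  prodF-denominator i = trans (prodF-cong L (λ j _ → denominator-classify (suc j)) i)
    (trans (prodF-isSpecial P⁺ (suc k) ℕP.≤-refl i)
           (prodF-cong (suc k) (λ j _ l → cong (λ e → (one ⊖ mono (- 1ℤ) e) l) (progression≡ j)) i))

  prodF-numerator : prodF (λ i → numerator (classify (suc i)) (suc i)) L ≈ (mono 1ℤ e₁ ⊗ ∏P⁻-special) ⊗ critical-factor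
  prodF-numerator i = begin
    prodF (λ i → numerator (classify (suc i)) (suc i)) L i
      ≡⟨ prodF-cong L (λ j _ → numerator-classify (suc j)) i ⟩
    prodF (λ j → at-special (suc j) ⊗ at-m (suc j)) L i
      ≡⟨ prodF-⊗ (at-special ∘ suc) (at-m ∘ suc) L i ⟩
    (prodF (at-special ∘ suc) L ⊗ prodF (at-m ∘ suc) L) i
      ≡⟨ ⊗-cong (λ j → trans (prodF-isSpecial (λ s → mono 1ℤ s ⊗ P⁻ s) k (ℕP.n≤1+n k) j) (specials j)) (prodF-at-m critical-factor) i ⟩
    ((mono 1ℤ e₁ ⊗ ∏P⁻-special) ⊗ critical-factor) i ∎
    where
    open ≡-Reasoning
    at-special at-m : ℕ → PS
    at-special s = if isSpecial k s then mono 1ℤ s ⊗ P⁻ s else one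
    at-m s = if s ≡ᵇ m then critical-factor else one
    specials : prodF (λ j → mono 1ℤ (j * A + a) ⊗ P⁻ (j * A + a)) k ≈ mono 1ℤ e₁ ⊗ ∏P⁻-special
    specials j = trans (prodF-⊗ (λ j → mono 1ℤ (j * A + a)) (λ j → P⁻ (j * A + a)) k j)
      (⊗-cong (progression-powers k) (prodF-cong k (λ j _ l → cong (λ e → (one ⊖ mono 1ℤ e) l) (progression≡ j))) j)

  restrictedGF : PS
  restrictedGF = prodF (blockGF ∘ suc) L

  restrictedGF-⊗-denominators : restrictedGF ⊗ ∏P⁻ ⊗ ∏P⁺-progression ≈[ n ] ∏P⁺ ⊗ ((mono 1ℤ e₁ ⊗ ∏P⁻-special) ⊗ critical-factor)
  restrictedGF-⊗-denominators = begin
    restrictedGF ⊗ ∏P⁻ ⊗ ∏P⁺-progression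
      ≈⟨ ≈⇒≈[] n (λ i → sym (trans (prodF-⊗ (λ j → blockGF (suc j) ⊗ P⁻ (suc j)) (λ j → denominator (classify (suc j)) (suc j)) L i)
           (⊗-cong (λ l → trans (prodF-⊗ (blockGF ∘ suc) (P⁻ ∘ suc) L l) (⊗-cong {restrictedGF} (λ _ → refl) prodF-P⁻ l)) prodF-denominator i))) ⟩
    prodF (λ j → blockGF (suc j) ⊗ P⁻ (suc j) ⊗ denominator (classify (suc j)) (suc j)) L
      ≈⟨ prodF-cong[] L (λ j _ → classBlockGF-identity (classify (suc j)) (s≤s z≤n)) ⟩
    prodF (λ j → P⁺ (suc j) ⊗ numerator (classify (suc j)) (suc j)) L
      ≈⟨ ≈⇒≈[] n (λ i → trans (prodF-⊗ (P⁺ ∘ suc) (λ j → numerator (classify (suc j)) (suc j)) L i)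
           (⊗-cong prodF-P⁺ prodF-numerator i)) ⟩
    ∏P⁺ ⊗ ((mono 1ℤ e₁ ⊗ ∏P⁻-special) ⊗ critical-factor) ∎
    where open SetoidReasoning (≈[]-setoid n)

  n<L : n < L
  n<L = ℕP.m<m+n n (1≤progression k)

  restrictedGF-≈[]-rhsTerm : restrictedGF ≈[ n ] rhsTerm r A a k
  restrictedGF-≈[]-rhsTerm = begin
    restrictedGF
      ≈⟨ ≈[]-divide (poch-at-0 1ℤ 1 L ℕP.≤-refl) (≈[]-divide (poch-at-0 (- 1ℤ) A (suc k) 1≤a) restrictedGF-⊗-denominators) ⟩
    (∏P⁺ ⊗ ((mono 1ℤ e₁ ⊗ ∏P⁻-special) ⊗ critical-factor) ⊗ inv1 ∏P⁺-progression) ⊗ inv1 ∏P⁻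
      ≈⟨ ≈⇒≈[] n (⊗-Solver.solve 6 (λ p x q t d⁻¹ m⁻¹ → ((p ⊕′ ((x ⊕′ q) ⊕′ t)) ⊕′ d⁻¹) ⊕′ m⁻¹ ⊜ (p ⊕′ m⁻¹) ⊕′ ((x ⊕′ t) ⊕′ (q ⊕′ d⁻¹)))
                   (λ _ → refl) ∏P⁺ (mono 1ℤ e₁) ∏P⁻-special critical-factor (inv1 ∏P⁺-progression) (inv1 ∏P⁻)) ⟩
    (∏P⁺ ⊗ inv1 ∏P⁻) ⊗ ((mono 1ℤ e₁ ⊗ critical-factor) ⊗ fraction)
      ≈⟨ ≈⇒≈[] n (⊗-cong {∏P⁺ ⊗ inv1 ∏P⁻} (λ _ → refl) (λ i → trans (⊗-cong {g = fraction} (mono-⊗-P⁻ e₁ (m * (r ∸ 1))) (λ _ → refl) i)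
           (trans (⊗-distribʳ-⊖ (mono 1ℤ e₁) (mono 1ℤ (e₁ + m * (r ∸ 1))) fraction i)
                  (cong (λ e → (mono 1ℤ e₁ ⊗ fraction) i ℤ.- (mono 1ℤ e ⊗ fraction) i) (cong (e₁ +_) (ℕP.*-comm m (r ∸ 1))))))) ⟩
    (∏P⁺ ⊗ inv1 ∏P⁻) ⊗ (mono 1ℤ e₁ ⊗ fraction ⊖ mono 1ℤ e₂ ⊗ fraction)
      ≈⟨ ⊗-cong[] (⊗-cong[] (pochInf-≈[] (- 1ℤ) L n<L) (inv1-cong[] n (pochInf-≈[] 1ℤ L n<L))) (λ _ _ → refl) ⟨
    rhsTerm r A a k ∎
    where
    open SetoidReasoning (≈[]-setoid n)
    open ⊗-Solver using (_⊜_) renaming (_⊕_ to _⊕′_)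
    fraction = ∏P⁻-special ⊗ inv1 ∏P⁺-progression
    e₂ = e₁ + (r ∸ 1) * (k * A + a)

  rhsCoeff-progression : rhsCoeff r A a m n ≡ rhsTerm r A a k n
  rhsCoeff-progression = sumℤ-select-one (suc m) (λ j → rhsTerm r A a j n) k<1+m (≡ᵇ-refl m) (λ j j≢k → ≡ᵇ-≢ (j≢k ∘ progression-injective))
    where
    k<1+m : k < suc m
    k<1+m = s≤s (ℕP.≤-trans (ℕP.m≤m*n k A) (ℕP.m≤m+n (k * A) a))

open import Data.Nat using (_+_; _*_)
import Data.Nat.Properties as ℕP
open import Data.Integer using (+_)
open import Data.Fin using (Fin)
open import Data.Product using (Σ; _×_; _,_)
open import Function.Bundles using (_↔_)
open import Function.Properties.Inverse using (↔-trans; ↔-sym)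
open import Relation.Nullary using (yes; no)
open import Relation.Binary.PropositionalEquality
open GeneratingFunctions using (Fin0↔)

theorem2p11 : (A a r : ℕ) .{{_ : NonZero A}} → 1 ≤ a → a ≤ A → 2 ≤ r →
    (m n : ℕ) → Σ ℕ (λ c → (Fin c ↔ OMesSet r A a m n) × (+ c ≡ rhsCoeff r A a m n))
theorem2p11 A a r 1≤a a≤A 2≤r m n with Mes.progression? A a r 1≤a a≤A 2≤r m
... | yes (k , refl) =
  let c , count , c≡ = HasGF-Restricted L n in
  c , ↔-trans count (↔-sym OMesSet↔Level) ,
  trans c≡ (trans (restrictedGF-≈[]-rhsTerm n ℕP.≤-refl) (sym rhsCoeff-progression))
  where open SeriesIdentity A a r 1≤a a≤A 2≤r k n
... | no ¬progression = 0 , Fin0↔ (OMesSet-empty not-progression) , sym (rhsCoeff-≡0 n not-progression)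
  where
  open Mes A a r 1≤a a≤A 2≤r
  not-progression : ∀ j → j * A + a ≢ m
  not-progression j eq = ¬progression (j , eq)
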